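{- Let $n$ be a positive even integer and $j$ a positive integer, and let $L_2(n)$ be the lattice square graph with vertex set $\{1,\dots,n\}^2$, two vertices adjacent iff their coordinates agree in exactly one position. For $m=1,\dots,n/2$ let $C_m=\{(x,y): x\in\{1,\dots,n\},\ y\in\{2m-1,2m\}\}$. Then $\{C_1,\dots,C_{n/2}\}$ is an equitable partition of $L_2(n)$ with quotient matrix $nI+2(J-I)$, and there exists a directed strongly regular graph with parameter set $$\Big(n^2\big(1+\tfrac{jn}{2}\big),\; jn^2+2n-2,\; 2jn+2n-2,\; 2jn+n-2,\; 2jn+2\Big).$$
   Context: A directed strongly regular graph (DSRG) with parameters $(n,k,t,\lambda,\mu)$ is a loopless digraph on $n$ vertices whose adjacency matrix $A$ satisfies $AJ=JA=kJ$ and $A^2=tI+\lambda A+\mu(J-I-A)$; an undirected strongly regular graph counts as a DSRG with $t=k$. A partition of the vertices of an undirected graph is equitable with quotient matrix $Q=(q_{i,l})$ if every vertex of $C_i$ has exactly $q_{i,l}$ neighbours in $C_l$. $I,J$ are the $(n/2)\times(n/2)$ identity and all-ones matrices. -}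

module Defs where

open import Data.Nat using (ℕ; zero; suc; _+_; _*_; _∸_; _<_; _≡ᵇ_)
open import Data.Nat.DivMod using (_/_)
open import Data.Bool using (T?; Bool; true; false; if_then_else_; _∧_; _∨_; not)
open import Data.Fin using (Fin; toℕ; remQuot; _≟_)
open import Data.Fin.Properties using ()
open import Data.List using (List; filter; length)
open import Data.List.Base using (allFin)
open import Data.Product using (_×_; _,_; proj₁; proj₂)
open import Relation.Binary.PropositionalEquality using (_≡_)
open import Relation.Nullary.Decidable using (⌊_⌋)
open import Relation.Nullary using (¬_)

Digraph : ℕ → Set
Digraph N = Fin N → Fin N → Bool

count : ∀ {N} → (Fin N → Bool) → ℕ
count {N} P = length (filter (λ w → T? (P w)) (allFin N))

-- Directed strongly regular graph with parameters (N,k,t,λ,μ):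
-- loopless, AJ = JA = kJ, A² = tI + λA + μ(J - I - A) (entrywise).
record IsDSRG (N k t λ' μ : ℕ) (A : Digraph N) : Set where
  field
    loopless : ∀ v → A v v ≡ false
    outDeg   : ∀ v → count (λ w → A v w) ≡ k
    inDeg    : ∀ v → count (λ w → A w v) ≡ k
    sqDiag   : ∀ v → count (λ w → A v w ∧ A w v) ≡ t
    sqAdj    : ∀ u v → ¬ (u ≡ v) → A u v ≡ true →
                 count (λ w → A u w ∧ A w v) ≡ λ'
    sqNonAdj : ∀ u v → ¬ (u ≡ v) → A u v ≡ false →
                 count (λ w → A u w ∧ A w v) ≡ μ

record IsEquitable (N m : ℕ) (A : Digraph N) (part : Fin N → ℕ) (Q : ℕ → ℕ → ℕ) : Set where
  field
    partBound : ∀ v → part v < m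
    partNonempty : ∀ i → i < m → Data.Product.∃ λ v → part v ≡ i
    regular : ∀ v l → l < m → count (λ w → A v w ∧ (part w ≡ᵇ l)) ≡ Q (part v) l

coord : ∀ n → Fin (n * n) → Fin n × Fin n
coord n i = remQuot n i

L2 : ∀ n → Digraph (n * n)
L2 n u v with coord n u | coord n v
... | (x , y) | (x' , y') =
  let ex = ⌊ x ≟ x' ⌋ ; ey = ⌊ y ≟ y' ⌋ in (ex ∧ not ey) ∨ (not ex ∧ ey)

-- The partition C_m = {(x,y) : y ∈ {2m-1, 2m}} (1-based); 0-based: part index ⌊y/2⌋.
pairPart : ∀ n → Fin (n * n) → ℕ
pairPart n v = toℕ (proj₂ (coord n v)) / 2

quotL2 : ℕ → ℕ → ℕ → ℕ
quotL2 n i l = if i ≡ᵇ l then n else 2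

-- Part 1.  The rows of the lattice square graph L₂(n) are grouped into the m pairs
-- {2p, 2p + 1}; a vertex (x, y) has n neighbours in its own pair (the n - 1 other vertices of
-- row y and the other vertex (x, y') of its pair) and 2 neighbours in every other pair.
--
-- Part 2.  The digraph: over each vertex (x, y) of L₂(n) sit 1 + jm vertices, one labelled ⋆
-- and one labelled (i, c) for every copy i < j and pair c < m.  Arcs depend only on whether the
-- columns agree (matrices H and F on the points (y, label)), so the adjacency matrix is
-- I ⊗ H + (J - I) ⊗ F.  Out- and in-degrees and two-step walk counts therefore reduce to sums
-- over points of explicit weights (outWeight, and the walk weights `same` and `cross`), which
-- are evaluated by splitting the points into ⋆-points and blocks (p, i) of labelled points: all
-- blocks but the one or two containing an endpoint contribute uniformly.
module Submission where

open import Defs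
open import Data.Nat using (ℕ; zero; suc; _+_; _*_; _∸_; _<_; _≡ᵇ_; s≤s)
open import Data.Nat.Properties
  using (+-comm; +-assoc; +-identityʳ; *-comm; *-zeroʳ; *-identityʳ; +-cancelʳ-≡; *-monoˡ-<; m+n∸n≡m;
         +-*-semiring; +-commutativeSemigroup; *-commutativeSemigroup)
open import Data.Nat.DivMod using (_/_; m*n/n≡m; m<n*o⇒m/o<n; +-distrib-/-∣ˡ)
open import Data.Nat.Divisibility using (_∣_; divides)
open import Data.Bool using (Bool; true; false; if_then_else_; _∧_; _∨_; not)
open import Data.Bool.Properties using (∨-identityʳ)
open import Data.Fin using (Fin; zero; suc; toℕ; fromℕ<; _↑ˡ_; _↑ʳ_; combine; remQuot; _≟_)
open import Data.Fin.Properties using (combine-injective; remQuot-combine; combine-remQuot; toℕ-combine; toℕ-fromℕ<; toℕ<n)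
open import Data.List using (filter; length; tabulate)
open import Data.Product using (_×_; Σ; _,_; proj₁; proj₂; ∃)
open import Function using (_∘_; id)
open import Relation.Binary.PropositionalEquality
  using (_≡_; refl; sym; trans; cong; cong₂; subst; module ≡-Reasoning)
open import Relation.Nullary using (¬_; yes; no; contradiction)
open import Relation.Nullary.Decidable using (⌊_⌋; T?)
open import Data.Nat.Tactic.RingSolver using (solve-∀)
open import Algebra.Properties.CommutativeSemigroup +-commutativeSemigroup using (xy∙z≈xz∙y)
open import Algebra.Properties.CommutativeSemigroup *-commutativeSemigroup using () renaming (x∙yz≈y∙xz to *-exchange)
open import Algebra.Properties.Semiring.Sum +-*-semiring
  using (sum; sum-syntax; sum-cong-≗; ∑-distrib-+; ∑-comm; sum-replicate-zero; *-distribˡ-sum)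

open ≡-Reasoning

infixr 5 _∙_
_∙_ : ∀ {A : Set} {x y z : A} → x ≡ y → y ≡ z → x ≡ z
_∙_ = trans

⟦_⟧ : Bool → ℕ
⟦ true ⟧ = 1
⟦ false ⟧ = 0

-- Boolean equality on Fin k, by structural recursion so that it computes on
-- constructors (the library's ⌊ a ≟ b ⌋ does not reduce under `suc`).
_==_ : ∀ {k} → Fin k → Fin k → Bool
zero == zero = true
zero == suc _ = false
suc _ == zero = false
suc a == suc b = a == b

infix 7 _==_

==-refl : ∀ {k} (a : Fin k) → (a == a) ≡ true
==-refl zero = refl
==-refl (suc a) = ==-refl a

==⇒≡ : ∀ {k} (a b : Fin k) → (a == b) ≡ true → a ≡ b
==⇒≡ zero zero _ = refl
==⇒≡ (suc a) (suc b) h = cong suc (==⇒≡ a b h)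

≢⇒==false : ∀ {k} {a b : Fin k} → ¬ a ≡ b → (a == b) ≡ false
≢⇒==false {a = a} {b} a≢b with a == b in h
... | true = contradiction (==⇒≡ a b h) a≢b
... | false = refl

==false⇒≢ : ∀ {k} {a b : Fin k} → (a == b) ≡ false → ¬ a ≡ b
==false⇒≢ {a = a} a≠b refl with trans (sym (==-refl a)) a≠b
... | ()

==-sym : ∀ {k} (a b : Fin k) → (a == b) ≡ (b == a)
==-sym zero zero = refl
==-sym zero (suc b) = refl
==-sym (suc a) zero = refl
==-sym (suc a) (suc b) = ==-sym a b

⌊≟⌋≡== : ∀ {k} (a b : Fin k) → ⌊ a ≟ b ⌋ ≡ (a == b)
⌊≟⌋≡== a b with a ≟ b
... | yes refl = sym (==-refl a)
... | no a≢b = sym (≢⇒==false a≢b)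

∑-const : ∀ k c → ∑[ i < k ] c ≡ k * c
∑-const zero c = refl
∑-const (suc k) c = cong (c +_) (∑-const k c)

∑-*ˡ : ∀ {k} c (f : Fin k → ℕ) → ∑[ i < k ] (c * f i) ≡ c * sum f
∑-*ˡ c f = sym (*-distribˡ-sum c f)

∑-↑ : ∀ a b (f : Fin (a + b) → ℕ) → sum f ≡ ∑[ i < a ] f (i ↑ˡ b) + ∑[ i < b ] f (a ↑ʳ i)
∑-↑ zero b f = refl
∑-↑ (suc a) b f = cong (f zero +_) (∑-↑ a b (f ∘ suc)) ∙ sym (+-assoc (f zero) _ _)

∑-combine : ∀ a b (f : Fin (a * b) → ℕ) → sum f ≡ ∑[ i < a ] ∑[ k < b ] f (combine i k)
∑-combine zero b f = refl
∑-combine (suc a) b f =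
  ∑-↑ b (a * b) f ∙ cong (∑[ k < b ] f (k ↑ˡ (a * b)) +_) (∑-combine a b (f ∘ (b ↑ʳ_)))

∑-remQuot : ∀ a b (g : Fin a → Fin b → ℕ) →
  ∑[ w < a * b ] g (proj₁ (remQuot {a} b w)) (proj₂ (remQuot {a} b w)) ≡ ∑[ i < a ] ∑[ k < b ] g i k
∑-remQuot a b g = ∑-combine a b (λ w → g (proj₁ (remQuot {a} b w)) (proj₂ (remQuot {a} b w)))
  ∙ sum-cong-≗ λ i → sum-cong-≗ λ k → cong (λ ik → g (proj₁ ik) (proj₂ ik)) (remQuot-combine i k)

∑-δ : ∀ {k} (α : Fin k) (g : Fin k → ℕ) → ∑[ z < k ] (if z == α then g z else 0) ≡ g α
∑-δ {suc k} zero g = cong (g zero +_) (sum-replicate-zero k) ∙ +-identityʳ (g zero)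
∑-δ {suc k} (suc α) g = ∑-δ α (g ∘ suc)

∑-replace : ∀ {k} (α : Fin k) (g : Fin k → ℕ) u →
  ∑[ z < k ] (if z == α then u else g z) + g α ≡ sum g + u
∑-replace {suc k} zero g u = begin
  u + ∑[ z < k ] g (suc z) + g zero   ≡⟨ +-assoc u _ (g zero) ⟩
  u + (∑[ z < k ] g (suc z) + g zero) ≡⟨ +-comm u _ ⟩
  ∑[ z < k ] g (suc z) + g zero + u   ≡⟨ cong (_+ u) (+-comm _ (g zero)) ⟩
  g zero + ∑[ z < k ] g (suc z) + u   ∎
∑-replace {suc k} (suc α) g u = begin
  g zero + R + g (suc α)        ≡⟨ +-assoc (g zero) R _ ⟩
  g zero + (R + g (suc α))      ≡⟨ cong (g zero +_) (∑-replace α (g ∘ suc) u) ⟩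
  g zero + (sum (g ∘ suc) + u)  ≡⟨ sym (+-assoc (g zero) _ u) ⟩
  g zero + sum (g ∘ suc) + u    ∎
  where R = ∑[ z < k ] (if z == α then u else g (suc z))

∑-pt : ∀ {k} (α : Fin (suc k)) u v → ∑[ z < suc k ] (if α == z then u else v) ≡ u + k * v
∑-pt {k} α u v = +-cancelʳ-≡ v _ _ (begin
  ∑[ z < suc k ] (if α == z then u else v) + v ≡⟨ cong (_+ v) (sum-cong-≗ {suc k} λ z → cong (λ b → if b then u else v) (==-sym α z)) ⟩
  ∑[ z < suc k ] (if z == α then u else v) + v ≡⟨ ∑-replace α (λ _ → v) u ⟩
  ∑[ z < suc k ] v + u                         ≡⟨ cong (_+ u) (∑-const (suc k) v) ⟩
  v + k * v + u                                ≡⟨ +-comm (v + k * v) u ⟩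
  u + (v + k * v)                              ≡⟨ cong (u +_) (+-comm v (k * v)) ⟩
  u + (k * v + v)                              ≡⟨ sym (+-assoc u (k * v) v) ⟩
  u + k * v + v                                ∎)

∑-δˡ : ∀ {k} (α : Fin k) v → ∑[ z < k ] (if α == z then v else 0) ≡ v
∑-δˡ {k} α v = sum-cong-≗ {k} (λ z → cong (λ b → if b then v else 0) (==-sym α z)) ∙ ∑-δ α (λ _ → v)

combine-== : ∀ {M J} (a : Fin M) (b : Fin J) a' b' → (combine a b == combine a' b') ≡ (a == a' ∧ b == b')
combine-== a b a' b' with a == a' in a=a' | b == b' in b=b'
... | true | true rewrite ==⇒≡ a a' a=a' | ==⇒≡ b b' b=b' = ==-refl (combine a' b')
... | true | false = ≢⇒==false (λ ab≡a'b' → ==false⇒≢ b=b' (proj₂ (combine-injective a b a' b' ab≡a'b')))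
... | false | _ = ≢⇒==false (λ ab≡a'b' → ==false⇒≢ a=a' (proj₁ (combine-injective a b a' b' ab≡a'b')))

∑-agree : ∀ {k} (α : Fin k) (f g : Fin k → ℕ) → (∀ z → (z == α) ≡ false → f z ≡ g z) →
  sum f + g α ≡ sum g + f α
∑-agree {k} α f g agree = cong (_+ g α) (sum-cong-≗ {k} f≡) ∙ ∑-replace α g (f α)
  where
  f≡ : ∀ z → f z ≡ (if z == α then f α else g z)
  f≡ z with z == α in z=α
  ... | true = cong f (==⇒≡ z α z=α)
  ... | false = agree z z=α

∑-agree₂ : ∀ {k} (α β : Fin k) (f g : Fin k → ℕ) → (β == α) ≡ false →
  (∀ z → (z == α) ≡ false → (z == β) ≡ false → f z ≡ g z) →
  sum f + g α + g β ≡ sum g + f α + f β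
∑-agree₂ {k} α β f g β≠α agree = begin
  sum f + g α + g β  ≡⟨ cong (λ r → sum f + r + g β) (sym hα) ⟩
  sum f + h α + g β  ≡⟨ cong (_+ g β) (∑-agree α f h f≡h) ⟩
  sum h + f α + g β  ≡⟨ xy∙z≈xz∙y (sum h) (f α) (g β) ⟩
  sum h + g β + f α  ≡⟨ cong (_+ f α) (∑-agree β h g h≡g) ⟩
  sum g + h β + f α  ≡⟨ cong (λ r → sum g + r + f α) hβ ⟩
  sum g + f β + f α  ≡⟨ xy∙z≈xz∙y (sum g) (f β) (f α) ⟩
  sum g + f α + f β  ∎
  where
  h : Fin k → ℕ
  h z = if z == α then g z else f z
  f≡h : ∀ z → (z == α) ≡ false → f z ≡ h z
  f≡h z z≠α rewrite z≠α = refl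
  h≡g : ∀ z → (z == β) ≡ false → h z ≡ g z
  h≡g z z≠β with z == α in z=α
  ... | true = refl
  ... | false = agree z z=α z≠β
  hα : h α ≡ g α
  hα rewrite ==-refl α = refl
  hβ : h β ≡ f β
  hβ rewrite β≠α = refl

-- A function taking values u at α, w at β ≠ α, and v elsewhere (stated without cancelling
-- the two missing copies of v, so that it holds for every k).
∑-pt₂ : ∀ {k} (α β : Fin k) u w v → (β == α) ≡ false →
  ∑[ z < k ] (if z == α then u else (if z == β then w else v)) + v + v ≡ u + w + k * v
∑-pt₂ {k} α β u w v β≠α = begin
  sum f + v + v         ≡⟨ cong (λ r → sum f + r + v) (sym gα) ⟩
  sum f + g α + v       ≡⟨ cong (_+ v) (∑-agree α f g f≡g) ⟩
  sum g + f α + v       ≡⟨ cong (λ r → sum g + r + v) fα ⟩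
  sum g + u + v         ≡⟨ xy∙z≈xz∙y (sum g) u v ⟩
  sum g + v + u         ≡⟨ cong (_+ u) (∑-agree β g (λ _ → v) g≡v) ⟩
  ∑[ z < k ] v + g β + u ≡⟨ cong₂ (λ a b → a + b + u) (∑-const k v) gβ ⟩
  k * v + w + u         ≡⟨ rearrange (k * v) w u ⟩
  u + w + k * v         ∎
  where
  f g : Fin k → ℕ
  f z = if z == α then u else (if z == β then w else v)
  g z = if z == β then w else v
  fα : f α ≡ u
  fα rewrite ==-refl α = refl
  gα : g α ≡ v
  gα rewrite ==-sym α β | β≠α = refl
  gβ : g β ≡ w
  gβ rewrite ==-refl β = refl
  f≡g : ∀ z → (z == α) ≡ false → f z ≡ g z
  f≡g z z≠α rewrite z≠α = refl
  g≡v : ∀ z → (z == β) ≡ false → g z ≡ v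
  g≡v z z≠β rewrite z≠β = refl
  rearrange : ∀ kv w u → kv + w + u ≡ u + w + kv
  rearrange = solve-∀

module _ {M J : ℕ} (f : Fin M → Fin J → ℕ) (G : Fin M → ℕ) where

  private
    outer : Fin (M * J) → Fin M
    inner : Fin (M * J) → Fin J
    outer z = proj₁ (remQuot {M} J z)
    inner z = proj₂ (remQuot {M} J z)

    flatF flatG : Fin (M * J) → ℕ
    flatF z = f (outer z) (inner z)
    flatG z = G (outer z)

    ∑flatF : sum flatF ≡ ∑[ p' < M ] ∑[ i' < J ] f p' i'
    ∑flatF = ∑-remQuot M J f

    ∑flatG : sum flatG ≡ J * sum G
    ∑flatG = begin
      sum flatG                     ≡⟨ ∑-remQuot M J (λ p' _ → G p') ⟩
      ∑[ p' < M ] ∑[ i' < J ] G p'  ≡⟨ sum-cong-≗ {M} (λ p' → ∑-const J (G p')) ⟩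
      ∑[ p' < M ] (J * G p')        ≡⟨ ∑-*ˡ J G ⟩
      J * sum G                     ∎

    at-combine : ∀ (h : Fin M → Fin J → ℕ) p i → h (outer (combine p i)) (inner (combine p i)) ≡ h p i
    at-combine h p i = cong (λ pi → h (proj₁ pi) (proj₂ pi)) (remQuot-combine p i)

    off-combine : ∀ z p i → (z == combine p i) ≡ false → (p == outer z ∧ i == inner z) ≡ false
    off-combine z p i z≠pi with p == outer z in p=outer | i == inner z in i=inner
    ... | false | _ = refl
    ... | true | false = refl
    ... | true | true = contradiction (begin
          true                              ≡⟨ sym (==-refl z) ⟩
          z == z                            ≡⟨ cong (z ==_) (sym (combine-remQuot {M} J z)) ⟩
          z == combine (outer z) (inner z)  ≡⟨ cong₂ (λ a b → z == combine a b) (sym (==⇒≡ p (outer z) p=outer)) (sym (==⇒≡ i (inner z) i=inner)) ⟩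
          z == combine p i                  ≡⟨ z≠pi ⟩
          false                             ∎) λ ()

  ∑₂-agree : ∀ p i → (∀ p' i' → (p == p' ∧ i == i') ≡ false → f p' i' ≡ G p') →
    ∑[ p' < M ] ∑[ i' < J ] f p' i' + G p ≡ f p i + J * sum G
  ∑₂-agree p i agree = begin
    ∑[ p' < M ] ∑[ i' < J ] f p' i' + G p        ≡⟨ cong₂ _+_ (sym ∑flatF) (sym (at-combine (λ p' _ → G p') p i)) ⟩
    sum flatF + flatG (combine p i)              ≡⟨ ∑-agree (combine p i) flatF flatG (λ z z≠pi → agree _ _ (off-combine z p i z≠pi)) ⟩
    sum flatG + flatF (combine p i)              ≡⟨ cong₂ _+_ ∑flatG (at-combine f p i) ⟩
    J * sum G + f p i                            ≡⟨ +-comm (J * sum G) (f p i) ⟩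
    f p i + J * sum G                            ∎

  ∑₂-agree₂ : ∀ p i p₂ i₂ → (p == p₂ ∧ i == i₂) ≡ false →
    (∀ p' i' → (p == p' ∧ i == i') ≡ false → (p₂ == p' ∧ i₂ == i') ≡ false → f p' i' ≡ G p') →
    ∑[ p' < M ] ∑[ i' < J ] f p' i' + G p + G p₂ ≡ f p i + f p₂ i₂ + J * sum G
  ∑₂-agree₂ p i p₂ i₂ distinct agree = begin
    ∑[ p' < M ] ∑[ i' < J ] f p' i' + G p + G p₂
      ≡⟨ cong₂ (λ a b → a + b + G p₂) (sym ∑flatF) (sym (at-combine (λ p' _ → G p') p i)) ⟩
    sum flatF + flatG α + G p₂
      ≡⟨ cong (sum flatF + flatG α +_) (sym (at-combine (λ p' _ → G p') p₂ i₂)) ⟩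
    sum flatF + flatG α + flatG β
      ≡⟨ ∑-agree₂ α β flatF flatG β≠α (λ z z≠α z≠β → agree _ _ (off-combine z p i z≠α) (off-combine z p₂ i₂ z≠β)) ⟩
    sum flatG + flatF α + flatF β
      ≡⟨ cong₂ _+_ (cong₂ _+_ ∑flatG (at-combine f p i)) (at-combine f p₂ i₂) ⟩
    J * sum G + f p i + f p₂ i₂
      ≡⟨ rotate (J * sum G) (f p i) (f p₂ i₂) ⟩
    f p i + f p₂ i₂ + J * sum G ∎
    where
    α β : Fin (M * J)
    α = combine p i
    β = combine p₂ i₂
    β≠α : (β == α) ≡ false
    β≠α = combine-== p₂ i₂ p i ∙ cong₂ _∧_ (==-sym p₂ p) (==-sym i₂ i) ∙ distinct
    rotate : ∀ a b c → a + b + c ≡ b + c + a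
    rotate = solve-∀

count≡∑ : ∀ {N} (P : Fin N → Bool) → count P ≡ ∑[ w < N ] ⟦ P w ⟧
count≡∑ {N} P = go N id
  where
  go : ∀ k (f : Fin k → Fin N) → length (filter (λ w → T? (P w)) (tabulate f)) ≡ ∑[ i < k ] ⟦ P (f i) ⟧
  go zero f = refl
  go (suc k) f with P (f zero)
  ... | true = cong suc (go k (f ∘ suc))
  ... | false = go k (f ∘ suc)

∑-at : ∀ {k} (y : Fin k) (P : Fin k → Bool) → ∑[ z < k ] ⟦ (y == z) ∧ P z ⟧ ≡ ⟦ P y ⟧
∑-at {k} y P = sum-cong-≗ {k} pointwise ∙ ∑-δ y (λ z → ⟦ P z ⟧)
  where
  pointwise : ∀ z → ⟦ (y == z) ∧ P z ⟧ ≡ (if z == y then ⟦ P z ⟧ else 0)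
  pointwise z rewrite ==-sym y z with z == y
  ... | true = refl
  ... | false = refl

∑-off : ∀ {k} (y : Fin k) (P : Fin k → Bool) → ∑[ z < k ] ⟦ not (y == z) ∧ P z ⟧ + ⟦ P y ⟧ ≡ ∑[ z < k ] ⟦ P z ⟧
∑-off {k} y P = begin
  ∑[ z < k ] ⟦ not (y == z) ∧ P z ⟧ + ⟦ P y ⟧                         ≡⟨ cong (∑[ z < k ] ⟦ not (y == z) ∧ P z ⟧ +_) (sym (∑-at y P)) ⟩
  ∑[ z < k ] ⟦ not (y == z) ∧ P z ⟧ + ∑[ z < k ] ⟦ (y == z) ∧ P z ⟧   ≡⟨ sym (∑-distrib-+ (λ z → ⟦ not (y == z) ∧ P z ⟧) (λ z → ⟦ (y == z) ∧ P z ⟧)) ⟩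
  ∑[ z < k ] (⟦ not (y == z) ∧ P z ⟧ + ⟦ (y == z) ∧ P z ⟧)           ≡⟨ sum-cong-≗ (λ z → split (y == z) (P z)) ⟩
  ∑[ z < k ] ⟦ P z ⟧                                                  ∎
  where
  split : ∀ b p → ⟦ not b ∧ p ⟧ + ⟦ b ∧ p ⟧ ≡ ⟦ p ⟧
  split true p = refl
  split false p = +-identityʳ ⟦ p ⟧

module PairPartition (m₀ : ℕ) where

  m n : ℕ
  m = suc m₀
  n = m * 2

  n/2≡m : n / 2 ≡ m
  n/2≡m = m*n/n≡m m 2

  half-combine : (p : Fin m) (e : Fin 2) → toℕ (combine p e) / 2 ≡ toℕ p
  half-combine p e = begin
    toℕ (combine p e) / 2       ≡⟨ cong (_/ 2) (toℕ-combine p e) ⟩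
    (2 * toℕ p + toℕ e) / 2     ≡⟨ +-distrib-/-∣ˡ (toℕ e) (divides (toℕ p) (*-comm 2 (toℕ p))) ⟩
    2 * toℕ p / 2 + toℕ e / 2   ≡⟨ cong₂ _+_ (cong (_/ 2) (*-comm 2 (toℕ p)) ∙ m*n/n≡m (toℕ p) 2) (e/2≡0 e) ⟩
    toℕ p + 0                   ≡⟨ +-identityʳ (toℕ p) ⟩
    toℕ p                       ∎
    where
    e/2≡0 : (e : Fin 2) → toℕ e / 2 ≡ 0
    e/2≡0 zero = refl
    e/2≡0 (suc zero) = refl

  ∑-toℕ≡ᵇ : ∀ {k} l → l < k → ∑[ p < k ] ⟦ toℕ p ≡ᵇ l ⟧ ≡ 1
  ∑-toℕ≡ᵇ {suc k} zero _ = cong suc (sum-replicate-zero k)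
  ∑-toℕ≡ᵇ {suc k} (suc l) (s≤s l<k) = ∑-toℕ≡ᵇ l l<k

  pairSize : ∀ l → l < m → ∑[ y < n ] ⟦ toℕ y / 2 ≡ᵇ l ⟧ ≡ 2
  pairSize l l<m = begin
    ∑[ y < n ] ⟦ toℕ y / 2 ≡ᵇ l ⟧                          ≡⟨ ∑-combine m 2 (λ y → ⟦ toℕ y / 2 ≡ᵇ l ⟧) ⟩
    ∑[ p < m ] ∑[ e < 2 ] ⟦ toℕ (combine p e) / 2 ≡ᵇ l ⟧   ≡⟨ sum-cong-≗ (λ p → sum-cong-≗ λ e → cong (λ r → ⟦ r ≡ᵇ l ⟧) (half-combine p e)) ⟩
    ∑[ p < m ] ∑[ e < 2 ] ⟦ toℕ p ≡ᵇ l ⟧                   ≡⟨ sum-cong-≗ {m} (λ p → ∑-const 2 ⟦ toℕ p ≡ᵇ l ⟧) ⟩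
    ∑[ p < m ] (2 * ⟦ toℕ p ≡ᵇ l ⟧)                        ≡⟨ ∑-*ˡ 2 (λ (p : Fin m) → ⟦ toℕ p ≡ᵇ l ⟧) ⟩
    2 * ∑[ p < m ] ⟦ toℕ p ≡ᵇ l ⟧                          ≡⟨ cong (2 *_) (∑-toℕ≡ᵇ {m} l l<m) ⟩
    2                                                      ∎

  -- In L₂(n) the neighbours of (x, y) are (x, y') with y' ≠ y and (x', y) with x' ≠ x.
  neighbour-split : ∀ b c q → ⟦ ((b ∧ not c) ∨ (not b ∧ c)) ∧ q ⟧ ≡ (if b then ⟦ not c ∧ q ⟧ else ⟦ c ∧ q ⟧)
  neighbour-split true c q rewrite ∨-identityʳ (not c) = refl
  neighbour-split false c q = refl

  regular : ∀ v l → l < n / 2 → count (λ w → L2 n v w ∧ (pairPart n w ≡ᵇ l)) ≡ quotL2 n (pairPart n v) l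
  regular v l l<n/2 = begin
    count (λ w → L2 n v w ∧ (pairPart n w ≡ᵇ l))                  ≡⟨ count≡∑ (λ w → L2 n v w ∧ (pairPart n w ≡ᵇ l)) ⟩
    ∑[ w < n * n ] ⟦ L2 n v w ∧ (pairPart n w ≡ᵇ l) ⟧              ≡⟨ ∑-remQuot n n g ⟩
    ∑[ x' < n ] ∑[ y' < n ] g x' y'                                ≡⟨ sum-cong-≗ {n} row ⟩
    ∑[ x' < n ] (if x == x' then sum A else ⟦ P y ⟧)               ≡⟨ ∑-pt x (sum A) ⟦ P y ⟧ ⟩
    sum A + suc (m₀ * 2) * ⟦ P y ⟧                                 ≡⟨ finish (sum A) (P y) (∑-off y P ∙ pairSize l l<m) ⟩
    quotL2 n (pairPart n v) l                                      ∎
    where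
    x = proj₁ (coord n v)
    y = proj₂ (coord n v)
    l<m = subst (l <_) n/2≡m l<n/2
    P : Fin n → Bool
    P y' = toℕ y' / 2 ≡ᵇ l
    A : Fin n → ℕ
    A y' = ⟦ not (y == y') ∧ P y' ⟧
    g : Fin n → Fin n → ℕ
    g x' y' = ⟦ ((⌊ x ≟ x' ⌋ ∧ not ⌊ y ≟ y' ⌋) ∨ (not ⌊ x ≟ x' ⌋ ∧ ⌊ y ≟ y' ⌋)) ∧ P y' ⟧
    g-split : ∀ x' y' → g x' y' ≡ (if x == x' then A y' else ⟦ (y == y') ∧ P y' ⟧)
    g-split x' y' rewrite ⌊≟⌋≡== x x' | ⌊≟⌋≡== y y' = neighbour-split (x == x') (y == y') (P y')
    row : ∀ x' → ∑[ y' < n ] g x' y' ≡ (if x == x' then sum A else ⟦ P y ⟧)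
    row x' = sum-cong-≗ {n} (g-split x') ∙ in-row (x == x')
      where
      in-row : ∀ b → ∑[ y' < n ] (if b then A y' else ⟦ (y == y') ∧ P y' ⟧) ≡ (if b then sum A else ⟦ P y ⟧)
      in-row true = refl
      in-row false = ∑-at y P
    finish : ∀ a b → a + ⟦ b ⟧ ≡ 2 → a + suc (m₀ * 2) * ⟦ b ⟧ ≡ (if b then n else 2)
    finish a true a+1≡2 = cong (_+ suc (m₀ * 2) * 1) (+-cancelʳ-≡ 1 a 1 a+1≡2) ∙ cong suc (*-identityʳ (suc (m₀ * 2)))
    finish a false a+0≡2 = cong₂ _+_ (sym (+-identityʳ a) ∙ a+0≡2) (*-zeroʳ (suc (m₀ * 2)))

  isEquitable : IsEquitable (n * n) (n / 2) (L2 n) (pairPart n) (quotL2 n)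
  isEquitable = record { partBound = partBound ; partNonempty = partNonempty ; regular = regular }
    where
    partBound : ∀ v → pairPart n v < n / 2
    partBound v = subst (pairPart n v <_) (sym n/2≡m) (m<n*o⇒m/o<n (toℕ<n (proj₂ (coord n v))))
    partNonempty : ∀ i → i < n / 2 → ∃ λ v → pairPart n v ≡ i
    partNonempty i i<n/2 = combine {n} {n} zero (fromℕ< 2i<n) , (begin
      toℕ (proj₂ (remQuot {n} n (combine {n} zero (fromℕ< 2i<n)))) / 2 ≡⟨ cong (λ xy → toℕ (proj₂ xy) / 2) (remQuot-combine {n} zero (fromℕ< 2i<n)) ⟩
      toℕ (fromℕ< 2i<n) / 2                                         ≡⟨ cong (_/ 2) (toℕ-fromℕ< 2i<n) ⟩
      i * 2 / 2                                                     ≡⟨ m*n/n≡m i 2 ⟩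
      i                                                             ∎)
      where
      2i<n : i * 2 < n
      2i<n = *-monoˡ-< 2 (subst (i <_) n/2≡m i<n/2)

module Construction (m₀ j : ℕ) where

  m n n₁ n₂ : ℕ
  m = suc m₀
  n = m * 2
  n₂ = m₀ * 2
  n₁ = suc n₂

  -- The parameters (k, t, λ, μ) = (jn² + 2n - 2, 2jn + 2n - 2, 2jn + n - 2, 2jn + 2).
  k' t' λ' μ' : ℕ
  k' = j * n * n + 2 + n₂ + n₂
  t' = 2 * j * n + 2 + n₂ + n₂
  λ' = 2 * j * n + n₂
  μ' = 2 * j * n + 2

  -- A vertex is a vertex (x, y) of L₂(n), y = 2p + e, together with a label: either ⋆ (a
  -- vertex of L₂(n) itself) or lab i c, the copy i < j attached to the pair of rows c < m.
  data Label : Set where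
    ⋆ : Label
    lab : Fin j → Fin m → Label

  -- Arcs from (x, 2p+e, ℓ) to (x', 2p'+e', ℓ') are given by H when x = x' and by F when x ≠ x'.
  H F : Fin m → Fin 2 → Label → Fin m → Fin 2 → Label → Bool
  H p e ⋆ p' e' ⋆ = not (p == p' ∧ e == e')
  H p e ⋆ p' e' (lab i' c') = c' == p'
  H p e (lab i c) p' e' ⋆ = p' == p
  H p e (lab i c) p' e' (lab i' c') = if p == p' ∧ i == i' then (if e == e' then not (c == c') else true) else c' == p
  F p e ⋆ p' e' ⋆ = p == p' ∧ e == e'
  F p e ⋆ p' e' (lab i' c') = c' == p'
  F p e (lab i c) p' e' ⋆ = p' == p
  F p e (lab i c) p' e' (lab i' c') = if p == p' ∧ i == i' then (if e == e' then c == c' else false) else c' == p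

  H-irreflexive : ∀ p e ℓ → H p e ℓ p e ℓ ≡ false
  H-irreflexive p e ⋆ rewrite ==-refl p | ==-refl e = refl
  H-irreflexive p e (lab i c) rewrite ==-refl p | ==-refl i | ==-refl e | ==-refl c = refl

  ∑L : (Label → ℕ) → ℕ
  ∑L g = g ⋆ + ∑[ i < j ] ∑[ c < m ] g (lab i c)

  ∑Y : (Fin m → Fin 2 → Label → ℕ) → ℕ
  ∑Y h = ∑[ p < m ] ∑[ e < 2 ] ∑L (h p e)

  ∑Y-split : ∀ h → ∑Y h ≡ ∑[ p < m ] ∑[ e < 2 ] h p e ⋆ + ∑[ p < m ] ∑[ i < j ] ∑[ e < 2 ] ∑[ c < m ] h p e (lab i c)
  ∑Y-split h = begin
    ∑Y h
      ≡⟨ sum-cong-≗ {m} (λ p → ∑-distrib-+ (λ e → h p e ⋆) (λ e → ∑[ i < j ] ∑[ c < m ] h p e (lab i c))) ⟩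
    ∑[ p < m ] (∑[ e < 2 ] h p e ⋆ + ∑[ e < 2 ] ∑[ i < j ] ∑[ c < m ] h p e (lab i c))
      ≡⟨ ∑-distrib-+ (λ p → ∑[ e < 2 ] h p e ⋆) (λ p → ∑[ e < 2 ] ∑[ i < j ] ∑[ c < m ] h p e (lab i c)) ⟩
    ∑[ p < m ] ∑[ e < 2 ] h p e ⋆ + ∑[ p < m ] ∑[ e < 2 ] ∑[ i < j ] ∑[ c < m ] h p e (lab i c)
      ≡⟨ cong (∑[ p < m ] ∑[ e < 2 ] h p e ⋆ +_) (sum-cong-≗ {m} λ p → ∑-comm {2} {j} (λ e i → ∑[ c < m ] h p e (lab i c))) ⟩
    ∑[ p < m ] ∑[ e < 2 ] h p e ⋆ + ∑[ p < m ] ∑[ i < j ] ∑[ e < 2 ] ∑[ c < m ] h p e (lab i c)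
      ∎

  ∑-rows : ∀ (g : Fin n → ℕ) → ∑[ p < m ] ∑[ e < 2 ] g (combine p e) ≡ sum g
  ∑-rows g = sym (∑-combine m 2 g)

  ∑-pair : ∀ (e : Fin 2) u v → ∑[ e' < 2 ] (if e == e' then u else v) ≡ u + v
  ∑-pair zero u v = cong (u +_) (+-identityʳ v)
  ∑-pair (suc zero) u v = cong (v +_) (+-identityʳ u) ∙ +-comm v u

  via-cancel : ∀ {base rest g r target} → rest + g ≡ r → base + r ≡ target + g → base + rest ≡ target
  via-cancel {base} {rest} {g} rest+g≡r base+r≡ = +-cancelʳ-≡ g _ _ (+-assoc base rest g ∙ cong (base +_) rest+g≡r ∙ base+r≡)

  -- Number of arcs from a vertex to the n vertices of a point (p', e', ℓ'), if it has an arc to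
  -- the vertex in its own column iff h and to each vertex in another column iff f.
  outWeight : Bool → Bool → ℕ
  outWeight false false = 0
  outWeight true false = 1
  outWeight false true = n₁
  outWeight true true = n

  outWeight-diag : ∀ b → outWeight b b ≡ (if b then n else 0)
  outWeight-diag true = refl
  outWeight-diag false = refl

  deg : Fin m → Fin 2 → Label → Fin m → Fin 2 → Label → ℕ
  deg p e ℓ p' e' ℓ' = outWeight (H p e ℓ p' e' ℓ') (F p e ℓ p' e' ℓ')

  blockSum : ∀ (ω : Bool → Bool → ℕ) → ω false true ≡ n₁ → ω true false ≡ 1 → ∀ e c →
    ∑[ e' < 2 ] ∑[ c' < m ] ω (if e == e' then not (c == c') else true) (if e == e' then c == c' else false)
      ≡ n₁ + m₀ * 1 + m * 1
  blockSum ω ω01 ω10 e c = sum-cong-≗ {2} row ∙ ∑-pair e (n₁ + m₀ * 1) (m * 1)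
    where
    row : ∀ e' → ∑[ c' < m ] ω (if e == e' then not (c == c') else true) (if e == e' then c == c' else false)
                   ≡ (if e == e' then n₁ + m₀ * 1 else m * 1)
    row e' with e == e'
    ... | true = sum-cong-≗ {m} cell ∙ ∑-pt c n₁ 1
      where
      cell : ∀ c' → ω (not (c == c')) (c == c') ≡ (if c == c' then n₁ else 1)
      cell c' with c == c'
      ... | true = ω01
      ... | false = ω10
    ... | false = sum-cong-≗ {m} (λ _ → ω10) ∙ ∑-const m 1

  blockSumᵒ : ∀ (ω : Bool → Bool → ℕ) → ω false true ≡ n₁ → ω true false ≡ 1 → ∀ e c →
    ∑[ e' < 2 ] ∑[ c' < m ] ω (if e' == e then not (c' == c) else true) (if e' == e then c' == c else false)
      ≡ n₁ + m₀ * 1 + m * 1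
  blockSumᵒ ω ω01 ω10 e c =
    sum-cong-≗ {2} (λ e' → sum-cong-≗ {m} λ c' → cong₂ (λ a b → ω (if a then not b else true) (if a then b else false)) (==-sym e' e) (==-sym c' c))
    ∙ blockSum ω ω01 ω10 e c

  out-degree : ∀ p e ℓ → ∑Y (deg p e ℓ) ≡ k'
  out-degree p e ⋆ = ∑Y-split (deg p e ⋆) ∙ cong₂ _+_ base labelled ∙ total m₀ j
    where
    base : ∑[ p' < m ] ∑[ e' < 2 ] deg p e ⋆ p' e' ⋆ ≡ n₁ + n₁ * 1
    base = sum-cong-≗ {m} (λ p' → sum-cong-≗ {2} (cell p'))
         ∙ ∑-rows (λ y' → if combine p e == y' then n₁ else 1) ∙ ∑-pt (combine p e) n₁ 1
      where
      cell : ∀ p' e' → deg p e ⋆ p' e' ⋆ ≡ (if combine p e == combine p' e' then n₁ else 1)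
      cell p' e' rewrite combine-== p e p' e' with p == p' ∧ e == e'
      ... | true = refl
      ... | false = refl
    labelled : ∑[ p' < m ] ∑[ i' < j ] ∑[ e' < 2 ] ∑[ c' < m ] deg p e ⋆ p' e' (lab i' c') ≡ m * (j * (2 * n))
    labelled = sum-cong-≗ {m} (λ p' → sum-cong-≗ {j} (λ i' → sum-cong-≗ {2} λ e' →
                 sum-cong-≗ {m} (λ c' → outWeight-diag (c' == p')) ∙ ∑-δ p' (λ _ → n)) ∙ ∑-const j (2 * n))
             ∙ ∑-const m (j * (2 * n))
    total : ∀ a b → let n = suc a * 2; n₁ = suc (a * 2); n₂ = a * 2 in
      n₁ + n₁ * 1 + suc a * (b * (2 * n)) ≡ b * n * n + 2 + n₂ + n₂
    total = solve-∀
  out-degree p e (lab i c) = ∑Y-split (deg p e (lab i c))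
      ∙ via-cancel {base-part} (∑₂-agree f (λ _ → 2 * n) p i off-block)
                   (cong₂ _+_ base (cong₂ (λ a b → a + j * b) on-block (∑-const m (2 * n))) ∙ total m₀ j)
    where
    base-part labelled-part : ℕ
    base-part = ∑[ p' < m ] ∑[ e' < 2 ] deg p e (lab i c) p' e' ⋆
    f : Fin m → Fin j → ℕ
    f p' i' = ∑[ e' < 2 ] ∑[ c' < m ] deg p e (lab i c) p' e' (lab i' c')
    labelled-part = ∑[ p' < m ] ∑[ i' < j ] f p' i'
    base : base-part ≡ 2 * n
    base = sum-cong-≗ {m} pair ∙ ∑-δ p (λ _ → 2 * n)
      where
      pair : ∀ p' → ∑[ e' < 2 ] deg p e (lab i c) p' e' ⋆ ≡ (if p' == p then 2 * n else 0)
      pair p' with p' == p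
      ... | true = refl
      ... | false = refl
    off-block : ∀ p' i' → (p == p' ∧ i == i') ≡ false → f p' i' ≡ 2 * n
    off-block p' i' outside = sum-cong-≗ {2} λ e' → sum-cong-≗ {m} (cell e') ∙ ∑-δ p (λ _ → n)
      where
      cell : ∀ e' c' → deg p e (lab i c) p' e' (lab i' c') ≡ (if c' == p then n else 0)
      cell e' c' rewrite outside = outWeight-diag (c' == p)
    on-block : f p i ≡ n₁ + m₀ * 1 + m * 1
    on-block rewrite ==-refl p | ==-refl i = blockSum outWeight refl refl e c
    total : ∀ a b → let n = suc a * 2; n₁ = suc (a * 2); n₂ = a * 2 in
      2 * n + (n₁ + a * 1 + suc a * 1 + b * (suc a * (2 * n))) ≡ b * n * n + 2 + n₂ + n₂ + 2 * n
    total = solve-∀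

  ∑-lab-const : ∀ v → ∑[ i' < j ] ∑[ e' < 2 ] ∑[ c' < m ] v ≡ j * (2 * (m * v))
  ∑-lab-const v = sum-cong-≗ {j} (λ _ → sum-cong-≗ {2} λ _ → ∑-const m v) ∙ ∑-const j (2 * (m * v))

  in-degree : ∀ p e ℓ → ∑Y (λ p' e' ℓ' → deg p' e' ℓ' p e ℓ) ≡ k'
  in-degree p e ⋆ = ∑Y-split (λ p' e' ℓ' → deg p' e' ℓ' p e ⋆) ∙ cong₂ _+_ base labelled ∙ total m₀ j
    where
    base : ∑[ p' < m ] ∑[ e' < 2 ] deg p' e' ⋆ p e ⋆ ≡ n₁ + n₁ * 1
    base = sum-cong-≗ {m} (λ p' → sum-cong-≗ {2} (cell p'))
         ∙ ∑-rows (λ y' → if combine p e == y' then n₁ else 1) ∙ ∑-pt (combine p e) n₁ 1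
      where
      cell : ∀ p' e' → deg p' e' ⋆ p e ⋆ ≡ (if combine p e == combine p' e' then n₁ else 1)
      cell p' e' rewrite combine-== p e p' e' | ==-sym p' p | ==-sym e' e with p == p' ∧ e == e'
      ... | true = refl
      ... | false = refl
    labelled : ∑[ p' < m ] ∑[ i' < j ] ∑[ e' < 2 ] ∑[ c' < m ] deg p' e' (lab i' c') p e ⋆ ≡ j * (2 * (m * n))
    labelled = sum-cong-≗ {m} pair ∙ ∑-δˡ p (j * (2 * (m * n)))
      where
      pair : ∀ p' → ∑[ i' < j ] ∑[ e' < 2 ] ∑[ c' < m ] deg p' e' (lab i' c') p e ⋆ ≡ (if p == p' then j * (2 * (m * n)) else 0)
      pair p' with p == p'
      ... | true = ∑-lab-const n
      ... | false = ∑-lab-const 0 ∙ cong (λ x → j * (2 * x)) (*-zeroʳ m) ∙ *-zeroʳ j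
    total : ∀ a b → let n = suc a * 2; n₁ = suc (a * 2); n₂ = a * 2 in
      n₁ + n₁ * 1 + b * (2 * (suc a * n)) ≡ b * n * n + 2 + n₂ + n₂
    total = solve-∀
  in-degree p e (lab i c) = ∑Y-split (λ p' e' ℓ' → deg p' e' ℓ' p e (lab i c))
      ∙ via-cancel {base-part} (∑₂-agree f G p i off-block)
                   (cong₂ _+_ base (cong₂ (λ a b → a + j * b) on-block ∑G) ∙ +-comm (G p) _ ∙ cong (_+ G p) (total m₀ j))
    where
    G : Fin m → ℕ
    G p' = 2 * (m * outWeight (c == p') (c == p'))
    base-part : ℕ
    base-part = ∑[ p' < m ] ∑[ e' < 2 ] deg p' e' ⋆ p e (lab i c)
    f : Fin m → Fin j → ℕ
    f p' i' = ∑[ e' < 2 ] ∑[ c' < m ] deg p' e' (lab i' c') p e (lab i c)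
    base : base-part ≡ G p
    base = ∑-const m (2 * outWeight (c == p) (c == p)) ∙ *-exchange m 2 (outWeight (c == p) (c == p))
    ∑G : sum G ≡ 2 * (m * n)
    ∑G = ∑-*ˡ 2 (λ p' → m * outWeight (c == p') (c == p')) ∙ cong (2 *_) (∑-*ˡ m (λ p' → outWeight (c == p') (c == p'))
         ∙ cong (m *_) (sum-cong-≗ {m} (λ p' → outWeight-diag (c == p')) ∙ ∑-δˡ c n))
    off-block : ∀ p' i' → (p == p' ∧ i == i') ≡ false → f p' i' ≡ G p'
    off-block p' i' outside = sum-cong-≗ {2} (λ e' → sum-cong-≗ {m} (cell e') ∙ ∑-const m _)
      where
      cell : ∀ e' c' → deg p' e' (lab i' c') p e (lab i c) ≡ outWeight (c == p') (c == p')
      cell e' c' rewrite ==-sym p' p | ==-sym i' i | outside = refl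
    on-block : f p i ≡ n₁ + m₀ * 1 + m * 1
    on-block rewrite ==-refl p | ==-refl i = blockSumᵒ outWeight refl refl e c
    total : ∀ a b → let n = suc a * 2; n₁ = suc (a * 2); n₂ = a * 2 in
      n₁ + a * 1 + suc a * 1 + b * (2 * (suc a * n)) ≡ b * n * n + 2 + n₂ + n₂
    total = solve-∀

  -- Number of middle vertices of two-step walks u → w → v, w ranging over the n vertices of
  -- one point, when u and v lie in different columns; the steps exist within a column iff
  -- h₁ (resp. h₂) and between columns iff f₁ (resp. f₂), and the arguments are h₁ ∧ f₂,
  -- f₁ ∧ h₂ and f₁ ∧ f₂.  (For u and v in the same column the count is
  -- outWeight (h₁ ∧ h₂) (f₁ ∧ f₂).)
  crossWeight : Bool → Bool → Bool → ℕ
  crossWeight a b false = ⟦ a ⟧ + ⟦ b ⟧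
  crossWeight a b true = ⟦ a ⟧ + ⟦ b ⟧ + n₂

  -- The two walk counts share the following values, which are all the computations of
  -- walks between vertices with different labels use.
  record WalkWeight : Set where
    field
      ω : Bool → Bool → Bool → Bool → ℕ
      no-first : ∀ h f → ω false false h f ≡ 0
      no-second : ∀ h f → ω h f false false ≡ 0
      uniform : ∀ a b → ω a a b b ≡ (if a then (if b then n else 0) else 0)
      ω0111 : ω false true true true ≡ n₁
      ω1011 : ω true false true true ≡ 1
      ω1101 : ω true true false true ≡ n₁
      ω1110 : ω true true true false ≡ 1

  same cross : WalkWeight
  same = record
    { ω = λ h₁ f₁ h₂ f₂ → outWeight (h₁ ∧ h₂) (f₁ ∧ f₂)
    ; no-first = λ _ _ → refl
    ; no-second = λ { true true → refl ; true false → refl ; false true → refl ; false false → refl }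
    ; uniform = λ { true b → outWeight-diag b ; false b → refl }
    ; ω0111 = refl ; ω1011 = refl ; ω1101 = refl ; ω1110 = refl
    }
  cross = record
    { ω = λ h₁ f₁ h₂ f₂ → crossWeight (h₁ ∧ f₂) (f₁ ∧ h₂) (f₁ ∧ f₂)
    ; no-first = λ _ _ → refl
    ; no-second = λ { true true → refl ; true false → refl ; false true → refl ; false false → refl }
    ; uniform = λ { true true → refl ; true false → refl ; false b → refl }
    ; ω0111 = refl ; ω1011 = refl ; ω1101 = refl ; ω1110 = refl
    }

  walk : WalkWeight → Fin m → Fin 2 → Label → Fin m → Fin 2 → Label → Fin m → Fin 2 → Label → ℕ
  walk W p e ℓ p' e' ℓ' p₂ e₂ ℓ₂ =
    WalkWeight.ω W (H p e ℓ p' e' ℓ') (F p e ℓ p' e' ℓ') (H p' e' ℓ' p₂ e₂ ℓ₂) (F p' e' ℓ' p₂ e₂ ℓ₂)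

  -- Walks through the labelled points; G p' is the contribution of a block (p', i') lying
  -- outside the blocks of both endpoints.
  module Walks (W : WalkWeight) where
    open WalkWeight W

    G : Fin m → Fin m → ℕ
    G c₂ p' = 2 * (if c₂ == p' then n else 0)

    ∑G : ∀ c₂ → sum (G c₂) ≡ 2 * n
    ∑G c₂ = ∑-*ˡ 2 (λ p' → if c₂ == p' then n else 0) ∙ cong (2 *_) (∑-δˡ c₂ n)

    ∑-uniform : ∀ (q : Fin m) b → ∑[ e' < 2 ] ∑[ c' < m ] ω (c' == q) (c' == q) b b ≡ 2 * (if b then n else 0)
    ∑-uniform q b = sum-cong-≗ {2} λ _ → sum-cong-≗ {m} (λ c' → uniform (c' == q) b) ∙ ∑-δ q (λ _ → if b then n else 0)

    ∑-⋆-uniform : ∀ (q : Fin m) b → ∑[ p' < m ] ∑[ e' < 2 ] ω (p' == q) (p' == q) b b ≡ 2 * (if b then n else 0)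
    ∑-⋆-uniform q b = sum-cong-≗ {m} pair ∙ ∑-δ q (λ _ → 2 * (if b then n else 0))
      where
      pair : ∀ p' → ∑[ e' < 2 ] ω (p' == q) (p' == q) b b ≡ (if p' == q then 2 * (if b then n else 0) else 0)
      pair p' = sum-cong-≗ {2} (λ _ → uniform (p' == q) b) ∙ lemma (p' == q)
        where
        lemma : ∀ a → ∑[ e' < 2 ] (if a then (if b then n else 0) else 0) ≡ (if a then 2 * (if b then n else 0) else 0)
        lemma true = refl
        lemma false = refl

    sourceBlock : ∀ e c b → ∑[ e' < 2 ] ∑[ c' < m ]
        ω (if e == e' then not (c == c') else true) (if e == e' then c == c' else false) b b
      ≡ (if b then n₁ + m₀ * 1 + m * 1 else 0)
    sourceBlock e c true = blockSum (λ h f → ω h f true true) ω0111 ω1011 e c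
    sourceBlock e c false = sum-cong-≗ {2} λ e' →
      sum-cong-≗ {m} (λ c' → no-second (if e == e' then not (c == c') else true) (if e == e' then c == c' else false))
      ∙ sum-replicate-zero m

    targetBlock : ∀ q e₂ c₂ → ∑[ e' < 2 ] ∑[ c' < m ]
        ω (c' == q) (c' == q) (if e' == e₂ then not (c' == c₂) else true) (if e' == e₂ then c' == c₂ else false)
      ≡ (if c₂ == q then n₁ else 1) + 1
    targetBlock q e₂ c₂ = sum-cong-≗ {2} (λ e' → sum-cong-≗ {m} (cell e') ∙ ∑-δ q (λ _ → V e'))
                        ∙ sum-cong-≗ {2} row ∙ ∑-pair e₂ _ 1 ∙ cong (_+ 1) (step (c₂ == q) (==-sym q c₂))
      where
      V : Fin 2 → ℕ
      V e' = ω true true (if e' == e₂ then not (q == c₂) else true) (if e' == e₂ then q == c₂ else false)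
      cell : ∀ e' c' → ω (c' == q) (c' == q) (if e' == e₂ then not (c' == c₂) else true) (if e' == e₂ then c' == c₂ else false)
                       ≡ (if c' == q then V e' else 0)
      cell e' c' with c' == q in c'=q
      ... | true rewrite ==⇒≡ c' q c'=q = refl
      ... | false = no-first _ _
      row : ∀ e' → V e' ≡ (if e₂ == e' then ω true true (not (q == c₂)) (q == c₂) else 1)
      row e' rewrite ==-sym e' e₂ with e₂ == e'
      ... | true = refl
      ... | false = ω1110
      step : ∀ b → (q == c₂) ≡ b → ω true true (not (q == c₂)) (q == c₂) ≡ (if b then n₁ else 1)
      step true q=c₂ rewrite q=c₂ = ω1101
      step false q≠c₂ rewrite q≠c₂ = ω1110

    walks-⋆→lab : ∀ p e p₂ e₂ i₂ c₂ →
      ∑Y (λ p' e' ℓ' → walk W p e ⋆ p' e' ℓ' p₂ e₂ (lab i₂ c₂)) ≡ (if c₂ == p₂ then λ' else μ')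
    walks-⋆→lab p e p₂ e₂ i₂ c₂ = ∑Y-split (λ p' e' ℓ' → walk W p e ⋆ p' e' ℓ' p₂ e₂ (lab i₂ c₂))
      ∙ via-cancel {base-part} (∑₂-agree f (G c₂) p₂ i₂ off-block)
          (cong₂ _+_ (base (c₂ == p₂)) (cong₂ (λ a b → a + j * b) on-block (∑G c₂)) ∙ finish (c₂ == p₂))
      where
      base-part : ℕ
      base-part = ∑[ p' < m ] ∑[ e' < 2 ] walk W p e ⋆ p' e' ⋆ p₂ e₂ (lab i₂ c₂)
      f : Fin m → Fin j → ℕ
      f p' i' = ∑[ e' < 2 ] ∑[ c' < m ] walk W p e ⋆ p' e' (lab i' c') p₂ e₂ (lab i₂ c₂)
      base : ∀ b → ∑[ p' < m ] ∑[ e' < 2 ] ω (not (p == p' ∧ e == e')) (p == p' ∧ e == e') b b ≡ (if b then n₁ + n₁ * 1 else 0)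
      base true = sum-cong-≗ {m} (λ p' → sum-cong-≗ {2} (cell p'))
                ∙ ∑-rows (λ y' → if combine p e == y' then n₁ else 1) ∙ ∑-pt (combine p e) n₁ 1
        where
        cell : ∀ p' e' → ω (not (p == p' ∧ e == e')) (p == p' ∧ e == e') true true ≡ (if combine p e == combine p' e' then n₁ else 1)
        cell p' e' rewrite combine-== p e p' e' with p == p' ∧ e == e'
        ... | true = ω0111
        ... | false = ω1011
      base false = sum-cong-≗ {m} (λ p' → sum-cong-≗ {2} λ e' → no-second (not (p == p' ∧ e == e')) (p == p' ∧ e == e'))
                 ∙ sum-replicate-zero m
      off-block : ∀ p' i' → (p₂ == p' ∧ i₂ == i') ≡ false → f p' i' ≡ G c₂ p'
      off-block p' i' outside rewrite ==-sym p' p₂ | ==-sym i' i₂ | outside = ∑-uniform p' (c₂ == p')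
      on-block : f p₂ i₂ ≡ (if c₂ == p₂ then n₁ else 1) + 1
      on-block rewrite ==-refl p₂ | ==-refl i₂ = targetBlock p₂ e₂ c₂
      finish : ∀ b → (if b then n₁ + n₁ * 1 else 0) + ((if b then n₁ else 1) + 1 + j * (2 * n))
                     ≡ (if b then λ' else μ') + 2 * (if b then n else 0)
      finish true = arithmetic m₀ j
        where
        arithmetic : ∀ a b → let n = suc a * 2; n₁ = suc (a * 2); n₂ = a * 2 in
          n₁ + n₁ * 1 + (n₁ + 1 + b * (2 * n)) ≡ 2 * b * n + n₂ + 2 * n
        arithmetic = solve-∀
      finish false = arithmetic m₀ j
        where
        arithmetic : ∀ a b → let n = suc a * 2 in 1 + 1 + b * (2 * n) ≡ 2 * b * n + 2 + 2 * 0
        arithmetic = solve-∀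

    walks-lab→⋆ : ∀ p e i c p₂ e₂ →
      ∑Y (λ p' e' ℓ' → walk W p e (lab i c) p' e' ℓ' p₂ e₂ ⋆) ≡ (if p₂ == p then λ' else μ')
    walks-lab→⋆ p e i c p₂ e₂ = ∑Y-split (λ p' e' ℓ' → walk W p e (lab i c) p' e' ℓ' p₂ e₂ ⋆)
      ∙ via-cancel {base-part} (∑₂-agree f (G p₂) p i off-block)
          (cong₂ _+_ base (cong₂ (λ a b → a + j * b) on-block (∑G p₂)) ∙ finish (p₂ == p))
      where
      base-part : ℕ
      base-part = ∑[ p' < m ] ∑[ e' < 2 ] walk W p e (lab i c) p' e' ⋆ p₂ e₂ ⋆
      f : Fin m → Fin j → ℕ
      f p' i' = ∑[ e' < 2 ] ∑[ c' < m ] walk W p e (lab i c) p' e' (lab i' c') p₂ e₂ ⋆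
      -- only the pair p of rows is reached by the first step
      W⋆ : ℕ
      W⋆ = ∑[ e' < 2 ] ω true true (not (p == p₂ ∧ e' == e₂)) (p == p₂ ∧ e' == e₂)
      base : base-part ≡ (if p₂ == p then n₁ + 1 else 2)
      base = sum-cong-≗ {m} pair ∙ ∑-δ p (λ _ → W⋆) ∙ rows (p₂ == p) refl
        where
        pair : ∀ p' → ∑[ e' < 2 ] walk W p e (lab i c) p' e' ⋆ p₂ e₂ ⋆ ≡ (if p' == p then W⋆ else 0)
        pair p' with p' == p in p'=p
        ... | true rewrite ==⇒≡ p' p p'=p = refl
        ... | false = cong₂ _+_ (no-first _ _) (cong (_+ 0) (no-first _ _))
        rows : ∀ b → (p₂ == p) ≡ b → W⋆ ≡ (if b then n₁ + 1 else 2)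
        rows true p₂=p rewrite ==-sym p p₂ | p₂=p =
          sum-cong-≗ {2} row ∙ ∑-pair e₂ n₁ 1
          where
          row : ∀ e' → ω true true (not (e' == e₂)) (e' == e₂) ≡ (if e₂ == e' then n₁ else 1)
          row e' rewrite ==-sym e' e₂ with e₂ == e'
          ... | true = ω1101
          ... | false = ω1110
        rows false p₂≠p rewrite ==-sym p p₂ | p₂≠p = cong₂ _+_ ω1110 (cong (_+ 0) ω1110)
      off-block : ∀ p' i' → (p == p' ∧ i == i') ≡ false → f p' i' ≡ G p₂ p'
      off-block p' i' outside rewrite outside = ∑-uniform p (p₂ == p')
      on-block : f p i ≡ (if p₂ == p then n₁ + m₀ * 1 + m * 1 else 0)
      on-block rewrite ==-refl p | ==-refl i = sourceBlock e c (p₂ == p)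
      finish : ∀ b → (if b then n₁ + 1 else 2) + ((if b then n₁ + m₀ * 1 + m * 1 else 0) + j * (2 * n))
                     ≡ (if b then λ' else μ') + 2 * (if b then n else 0)
      finish true = arithmetic m₀ j
        where
        arithmetic : ∀ a b → let n = suc a * 2; n₁ = suc (a * 2); n₂ = a * 2 in
          n₁ + 1 + (n₁ + a * 1 + suc a * 1 + b * (2 * n)) ≡ 2 * b * n + n₂ + 2 * n
        arithmetic = solve-∀
      finish false = arithmetic m₀ j
        where
        arithmetic : ∀ a b → let n = suc a * 2 in 2 + (0 + b * (2 * n)) ≡ 2 * b * n + 2 + 2 * 0
        arithmetic = solve-∀

    walks-lab→lab : ∀ p e i c p₂ e₂ i₂ c₂ → (p == p₂ ∧ i == i₂) ≡ false →
      ∑Y (λ p' e' ℓ' → walk W p e (lab i c) p' e' ℓ' p₂ e₂ (lab i₂ c₂)) ≡ (if c₂ == p then λ' else μ')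
    walks-lab→lab p e i c p₂ e₂ i₂ c₂ distinct = ∑Y-split (λ p' e' ℓ' → walk W p e (lab i c) p' e' ℓ' p₂ e₂ (lab i₂ c₂))
      ∙ +-cancelʳ-≡ (G c₂ p) _ _ (begin
          base-part + labelled-part + G c₂ p
            ≡⟨ cong (λ x → x + labelled-part + G c₂ p) base ⟩
          G c₂ p₂ + labelled-part + G c₂ p
            ≡⟨ rotate (G c₂ p₂) labelled-part (G c₂ p) ⟩
          labelled-part + G c₂ p + G c₂ p₂
            ≡⟨ ∑₂-agree₂ f (G c₂) p i p₂ i₂ distinct off-blocks ⟩
          f p i + f p₂ i₂ + j * sum (G c₂)
            ≡⟨ cong₂ (λ a b → a + j * b) (cong₂ _+_ source target) (∑G c₂) ⟩
          (if c₂ == p then n₁ + m₀ * 1 + m * 1 else 0) + ((if c₂ == p then n₁ else 1) + 1) + j * (2 * n)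
            ≡⟨ finish (c₂ == p) ⟩
          (if c₂ == p then λ' else μ') + G c₂ p
            ∎)
      where
      base-part labelled-part : ℕ
      base-part = ∑[ p' < m ] ∑[ e' < 2 ] walk W p e (lab i c) p' e' ⋆ p₂ e₂ (lab i₂ c₂)
      f : Fin m → Fin j → ℕ
      f p' i' = ∑[ e' < 2 ] ∑[ c' < m ] walk W p e (lab i c) p' e' (lab i' c') p₂ e₂ (lab i₂ c₂)
      labelled-part = ∑[ p' < m ] ∑[ i' < j ] f p' i'
      base : base-part ≡ G c₂ p₂
      base = ∑-⋆-uniform p (c₂ == p₂)
      off-blocks : ∀ p' i' → (p == p' ∧ i == i') ≡ false → (p₂ == p' ∧ i₂ == i') ≡ false → f p' i' ≡ G c₂ p'
      off-blocks p' i' outside outside₂ rewrite outside | ==-sym p' p₂ | ==-sym i' i₂ | outside₂ = ∑-uniform p (c₂ == p')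
      source : f p i ≡ (if c₂ == p then n₁ + m₀ * 1 + m * 1 else 0)
      source rewrite ==-refl p | ==-refl i | distinct = sourceBlock e c (c₂ == p)
      target : f p₂ i₂ ≡ (if c₂ == p then n₁ else 1) + 1
      target rewrite ==-refl p₂ | ==-refl i₂ | distinct = targetBlock p e₂ c₂
      rotate : ∀ a b c → a + b + c ≡ b + c + a
      rotate = solve-∀
      finish : ∀ b → (if b then n₁ + m₀ * 1 + m * 1 else 0) + ((if b then n₁ else 1) + 1) + j * (2 * n)
                     ≡ (if b then λ' else μ') + 2 * (if b then n else 0)
      finish true = arithmetic m₀ j
        where
        arithmetic : ∀ a b → let n = suc a * 2; n₁ = suc (a * 2); n₂ = a * 2 in
          n₁ + a * 1 + suc a * 1 + (n₁ + 1) + b * (2 * n) ≡ 2 * b * n + n₂ + 2 * n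
        arithmetic = solve-∀
      finish false = arithmetic m₀ j
        where
        arithmetic : ∀ a b → let n = suc a * 2 in 0 + (1 + 1) + b * (2 * n) ≡ 2 * b * n + 2 + 2 * 0
        arithmetic = solve-∀

    walks-⋆→⋆-labelled : ∀ p e p₂ e₂ →
      ∑[ p' < m ] ∑[ i' < j ] ∑[ e' < 2 ] ∑[ c' < m ] walk W p e ⋆ p' e' (lab i' c') p₂ e₂ ⋆ ≡ j * (2 * n)
    walks-⋆→⋆-labelled p e p₂ e₂ =
      sum-cong-≗ {m} (λ p' → sum-cong-≗ {j} (λ _ → ∑-uniform p' (p₂ == p')) ∙ ∑-const j (G p₂ p'))
      ∙ ∑-*ˡ j (G p₂) ∙ cong (j *_) (∑G p₂)

    walks-⋆→⋆-base : ∀ p e p₂ e₂ → ∑[ p' < m ] ∑[ e' < 2 ] walk W p e ⋆ p' e' ⋆ p₂ e₂ ⋆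
      ≡ ∑[ y' < n ] ω (not (combine p e == y')) (combine p e == y') (not (y' == combine p₂ e₂)) (y' == combine p₂ e₂)
    walks-⋆→⋆-base p e p₂ e₂ = sum-cong-≗ {m} (λ p' → sum-cong-≗ {2} (cell p'))
      ∙ ∑-rows (λ y' → ω (not (combine p e == y')) (combine p e == y') (not (y' == combine p₂ e₂)) (y' == combine p₂ e₂))
      where
      cell : ∀ p' e' → walk W p e ⋆ p' e' ⋆ p₂ e₂ ⋆
        ≡ ω (not (combine p e == combine p' e')) (combine p e == combine p' e') (not (combine p' e' == combine p₂ e₂)) (combine p' e' == combine p₂ e₂)
      cell p' e' rewrite combine-== p e p' e' | combine-== p' e' p₂ e₂ = refl

    ∑-rows-equal : ∀ Y → ∑[ y' < n ] ω (not (Y == y')) (Y == y') (not (y' == Y)) (y' == Y)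
                           ≡ ω false true false true + n₁ * ω true false true false
    ∑-rows-equal Y = sum-cong-≗ {n} cell ∙ ∑-pt Y _ _
      where
      cell : ∀ y' → ω (not (Y == y')) (Y == y') (not (y' == Y)) (y' == Y) ≡ (if Y == y' then ω false true false true else ω true false true false)
      cell y' rewrite ==-sym y' Y with Y == y'
      ... | true = refl
      ... | false = refl

    ∑-rows-distinct : ∀ Y Y₂ → (Y₂ == Y) ≡ false →
      ∑[ y' < n ] ω (not (Y == y')) (Y == y') (not (y' == Y₂)) (y' == Y₂) + ω true false true false + ω true false true false
        ≡ ω false true true false + ω true false false true + n * ω true false true false
    ∑-rows-distinct Y Y₂ Y₂≠Y = cong (λ s → s + ω true false true false + ω true false true false) (sum-cong-≗ {n} cell)
                              ∙ ∑-pt₂ Y Y₂ _ _ _ Y₂≠Y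
      where
      cell : ∀ y' → ω (not (Y == y')) (Y == y') (not (y' == Y₂)) (y' == Y₂)
                    ≡ (if y' == Y then ω false true true false else (if y' == Y₂ then ω true false false true else ω true false true false))
      cell y' rewrite ==-sym Y y' with y' == Y in y'=Y
      ... | true rewrite ==⇒≡ y' Y y'=Y | ==-sym Y Y₂ | Y₂≠Y = refl
      ... | false with y' == Y₂
      ...   | true = refl
      ...   | false = refl

    onBlock : Fin 2 → Fin m → Fin 2 → Fin m → ℕ
    onBlock e c e₂ c₂ = ∑[ e' < 2 ] ∑[ c' < m ]
      ω (if e == e' then not (c == c') else true) (if e == e' then c == c' else false)
        (if e' == e₂ then not (c' == c₂) else true) (if e' == e₂ then c' == c₂ else false)

    walks-sameBlock : ∀ p i e c e₂ c₂ →
      ∑Y (λ p' e' ℓ' → walk W p e (lab i c) p' e' ℓ' p e₂ (lab i c₂)) ≡ onBlock e c e₂ c₂ + j * (2 * n)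
    walks-sameBlock p i e c e₂ c₂ = ∑Y-split (λ p' e' ℓ' → walk W p e (lab i c) p' e' ℓ' p e₂ (lab i c₂))
      ∙ cong (_+ labelled-part) (∑-⋆-uniform p (c₂ == p)) ∙ +-comm (G c₂ p) labelled-part
      ∙ ∑₂-agree f (G c₂) p i off-block ∙ cong₂ (λ a b → a + j * b) on-block (∑G c₂)
      where
      f : Fin m → Fin j → ℕ
      f p' i' = ∑[ e' < 2 ] ∑[ c' < m ] walk W p e (lab i c) p' e' (lab i' c') p e₂ (lab i c₂)
      labelled-part : ℕ
      labelled-part = ∑[ p' < m ] ∑[ i' < j ] f p' i'
      off-block : ∀ p' i' → (p == p' ∧ i == i') ≡ false → f p' i' ≡ G c₂ p'
      off-block p' i' outside rewrite outside | ==-sym p' p | ==-sym i' i | outside = ∑-uniform p (c₂ == p')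
      on-block : f p i ≡ onBlock e c e₂ c₂
      on-block rewrite ==-refl p | ==-refl i = refl

    -- Evaluation of onBlock: the row e' of the middle vertex is e, e₂, or neither.
    private
      ∑-along : ∀ c → ∑[ c' < m ] ω (not (c == c')) (c == c') true false ≡ ω false true true false + m₀ * ω true false true false
      ∑-along c = sum-cong-≗ {m} cell ∙ ∑-pt c _ _
        where
        cell : ∀ c' → ω (not (c == c')) (c == c') true false ≡ (if c == c' then ω false true true false else ω true false true false)
        cell c' with c == c'
        ... | true = refl
        ... | false = refl

      ∑-alongᵒ : ∀ c₂ → ∑[ c' < m ] ω true false (not (c' == c₂)) (c' == c₂) ≡ ω true false false true + m₀ * ω true false true false
      ∑-alongᵒ c₂ = sum-cong-≗ {m} cell ∙ ∑-pt c₂ _ _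
        where
        cell : ∀ c' → ω true false (not (c' == c₂)) (c' == c₂) ≡ (if c₂ == c' then ω true false false true else ω true false true false)
        cell c' rewrite ==-sym c' c₂ with c₂ == c'
        ... | true = refl
        ... | false = refl

      onBlock-sameRow : ∀ e c c₂ → onBlock e c e c₂
        ≡ ∑[ c' < m ] ω (not (c == c')) (c == c') (not (c' == c₂)) (c' == c₂) + m * ω true false true false
      onBlock-sameRow e c c₂ = sum-cong-≗ {2} row ∙ ∑-pair e _ _
        where
        row : ∀ e' → ∑[ c' < m ] ω (if e == e' then not (c == c') else true) (if e == e' then c == c' else false)
                                    (if e' == e then not (c' == c₂) else true) (if e' == e then c' == c₂ else false)
                     ≡ (if e == e' then ∑[ c' < m ] ω (not (c == c')) (c == c') (not (c' == c₂)) (c' == c₂) else m * ω true false true false)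
        row e' rewrite ==-sym e' e with e == e'
        ... | true = refl
        ... | false = ∑-const m _

    onBlock-diagonal : ∀ e c → onBlock e c e c ≡ ω false true false true + m₀ * ω true false true false + m * ω true false true false
    onBlock-diagonal e c = onBlock-sameRow e c c ∙ cong (_+ m * ω true false true false) (sum-cong-≗ {m} cell ∙ ∑-pt c _ _)
      where
      cell : ∀ c' → ω (not (c == c')) (c == c') (not (c' == c)) (c' == c) ≡ (if c == c' then ω false true false true else ω true false true false)
      cell c' rewrite ==-sym c' c with c == c'
      ... | true = refl
      ... | false = refl

    onBlock-sameRow-distinct : ∀ e c c₂ → (c == c₂) ≡ false →
      onBlock e c e c₂ + ω true false true false + ω true false true false
        ≡ ω false true true false + ω true false false true + m * ω true false true false + m * ω true false true false
    onBlock-sameRow-distinct e c c₂ c≠c₂ = begin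
      onBlock e c e c₂ + w + w           ≡⟨ cong (λ s → s + w + w) (onBlock-sameRow e c c₂) ⟩
      sum cells + m * w + w + w          ≡⟨ shift (sum cells) (m * w) w ⟩
      sum cells + w + w + m * w          ≡⟨ cong (_+ m * w) (cong (λ s → s + w + w) (sum-cong-≗ {m} cell) ∙ ∑-pt₂ c c₂ _ _ _ (==-sym c₂ c ∙ c≠c₂)) ⟩
      ω false true true false + ω true false false true + m * w + m * w ∎
      where
      w : ℕ
      w = ω true false true false
      cells : Fin m → ℕ
      cells c' = ω (not (c == c')) (c == c') (not (c' == c₂)) (c' == c₂)
      cell : ∀ c' → cells c' ≡ (if c' == c then ω false true true false else (if c' == c₂ then ω true false false true else w))
      cell c' rewrite ==-sym c c' with c' == c in c'=c
      ... | true rewrite ==⇒≡ c' c c'=c | c≠c₂ = refl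
      ... | false with c' == c₂
      ...   | true = refl
      ...   | false = refl
      shift : ∀ s x w → s + x + w + w ≡ s + w + w + x
      shift = solve-∀

    onBlock-otherRow : ∀ e e₂ c c₂ → (e == e₂) ≡ false →
      onBlock e c e₂ c₂ ≡ ω false true true false + m₀ * ω true false true false + (ω true false false true + m₀ * ω true false true false)
    onBlock-otherRow zero (suc zero) c c₂ _ = cong₂ _+_ (∑-along c) (+-identityʳ _ ∙ ∑-alongᵒ c₂)
    onBlock-otherRow (suc zero) zero c c₂ _ = cong₂ _+_ (∑-alongᵒ c₂) (+-identityʳ _ ∙ ∑-along c)
      ∙ +-comm (ω true false false true + m₀ * ω true false true false) _
    onBlock-otherRow zero zero c c₂ ()
    onBlock-otherRow (suc zero) (suc zero) c c₂ ()

  open Walks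

  ∧-true : ∀ {a b} → (a ∧ b) ≡ true → a ≡ true × b ≡ true
  ∧-true {true} {true} _ = refl , refl

  walks-diagonal : ∀ p e ℓ → ∑Y (λ p' e' ℓ' → walk same p e ℓ p' e' ℓ' p e ℓ) ≡ t'
  walks-diagonal p e ⋆ = ∑Y-split (λ p' e' ℓ' → walk same p e ⋆ p' e' ℓ' p e ⋆)
    ∙ cong₂ _+_ (walks-⋆→⋆-base same p e p e ∙ ∑-rows-equal same (combine p e)) (walks-⋆→⋆-labelled same p e p e)
    ∙ arithmetic m₀ j
    where
    arithmetic : ∀ a b → let n = suc a * 2; n₁ = suc (a * 2); n₂ = a * 2 in
      n₁ + n₁ * 1 + b * (2 * n) ≡ 2 * b * n + 2 + n₂ + n₂
    arithmetic = solve-∀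
  walks-diagonal p e (lab i c) = walks-sameBlock same p i e c e c ∙ cong (_+ j * (2 * n)) (onBlock-diagonal same e c)
    ∙ arithmetic m₀ j
    where
    arithmetic : ∀ a b → let n = suc a * 2; n₁ = suc (a * 2); n₂ = a * 2 in
      n₁ + a * 1 + suc a * 1 + b * (2 * n) ≡ 2 * b * n + 2 + n₂ + n₂
    arithmetic = solve-∀

  cancel₂ : ∀ {S} w r extra target → S + w + w ≡ r → r + extra ≡ target + w + w → S + extra ≡ target
  cancel₂ {S} w r extra target S+w+w≡r r+extra≡ = +-cancelʳ-≡ (w + w) _ _ (begin
    S + extra + (w + w)  ≡⟨ shift S extra w ⟩
    S + w + w + extra    ≡⟨ cong (_+ extra) S+w+w≡r ⟩
    r + extra            ≡⟨ r+extra≡ ⟩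
    target + w + w       ≡⟨ +-assoc target w w ⟩
    target + (w + w)     ∎)
    where
    shift : ∀ s x w → s + x + (w + w) ≡ s + w + w + x
    shift = solve-∀

  rows-distinct : ∀ (p : Fin m) (e : Fin 2) p₂ e₂ → (p == p₂ ∧ e == e₂) ≡ false → (combine p₂ e₂ == combine p e) ≡ false
  rows-distinct p e p₂ e₂ u≠v = combine-== p₂ e₂ p e ∙ cong₂ _∧_ (==-sym p₂ p) (==-sym e₂ e) ∙ u≠v

  walks-sameColumn-block : ∀ p i e c e₂ c₂ → ¬ (e ≡ e₂ × c ≡ c₂) →
    ∑Y (λ p' e' ℓ' → walk same p e (lab i c) p' e' ℓ' p e₂ (lab i c₂)) ≡ (if (if e == e₂ then not (c == c₂) else true) then λ' else μ')
  walks-sameColumn-block p i e c e₂ c₂ u≢v with e == e₂ in row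
  ... | false = walks-sameBlock same p i e c e₂ c₂ ∙ cong (_+ j * (2 * n)) (onBlock-otherRow same e e₂ c c₂ row) ∙ arithmetic m₀ j
    where
    arithmetic : ∀ a b → let n = suc a * 2; n₂ = a * 2 in 0 + a * 1 + (0 + a * 1) + b * (2 * n) ≡ 2 * b * n + n₂
    arithmetic = solve-∀
  ... | true with ==⇒≡ e e₂ row | c == c₂ in col
  ...   | refl | true = contradiction (refl , ==⇒≡ c c₂ col) u≢v
  ...   | refl | false = walks-sameBlock same p i e c e c₂
    ∙ cancel₂ 1 _ (j * (2 * n)) λ' (onBlock-sameRow-distinct same e c c₂ col) (arithmetic m₀ j)
    where
    arithmetic : ∀ a b → let n = suc a * 2; n₂ = a * 2 in 0 + 0 + suc a * 1 + suc a * 1 + b * (2 * n) ≡ 2 * b * n + n₂ + 1 + 1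
    arithmetic = solve-∀

  walks-sameColumn : ∀ p e ℓ p₂ e₂ ℓ₂ → ¬ (p , e , ℓ) ≡ (p₂ , e₂ , ℓ₂) →
    ∑Y (λ p' e' ℓ' → walk same p e ℓ p' e' ℓ' p₂ e₂ ℓ₂) ≡ (if H p e ℓ p₂ e₂ ℓ₂ then λ' else μ')
  walks-sameColumn p e ⋆ p₂ e₂ ⋆ u≢v with p == p₂ ∧ e == e₂ in u=v
  ... | true = contradiction (cong₂ (λ a b → (a , b , ⋆)) (==⇒≡ p p₂ (proj₁ (∧-true u=v))) (==⇒≡ e e₂ (proj₂ (∧-true u=v)))) u≢v
  ... | false = ∑Y-split (λ p' e' ℓ' → walk same p e ⋆ p' e' ℓ' p₂ e₂ ⋆)
    ∙ cong₂ _+_ (walks-⋆→⋆-base same p e p₂ e₂) (walks-⋆→⋆-labelled same p e p₂ e₂)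
    ∙ cancel₂ 1 _ (j * (2 * n)) λ' (∑-rows-distinct same (combine p e) (combine p₂ e₂) (rows-distinct p e p₂ e₂ u=v)) (arithmetic m₀ j)
    where
    arithmetic : ∀ a b → let n = suc a * 2; n₂ = a * 2 in 0 + 0 + n * 1 + b * (2 * n) ≡ 2 * b * n + n₂ + 1 + 1
    arithmetic = solve-∀
  walks-sameColumn p e ⋆ p₂ e₂ (lab i₂ c₂) _ = walks-⋆→lab same p e p₂ e₂ i₂ c₂
  walks-sameColumn p e (lab i c) p₂ e₂ ⋆ _ = walks-lab→⋆ same p e i c p₂ e₂
  walks-sameColumn p e (lab i c) p₂ e₂ (lab i₂ c₂) u≢v with p == p₂ ∧ i == i₂ in block
  ... | false = walks-lab→lab same p e i c p₂ e₂ i₂ c₂ block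
  ... | true with ==⇒≡ p p₂ (proj₁ (∧-true block)) | ==⇒≡ i i₂ (proj₂ (∧-true block))
  ...   | refl | refl = walks-sameColumn-block p i e c e₂ c₂ λ { (refl , refl) → u≢v refl }

  walks-otherColumn-block : ∀ p i e c e₂ c₂ →
    ∑Y (λ p' e' ℓ' → walk cross p e (lab i c) p' e' ℓ' p e₂ (lab i c₂)) ≡ (if (if e == e₂ then c == c₂ else false) then λ' else μ')
  walks-otherColumn-block p i e c e₂ c₂ with e == e₂ in row
  ... | false = walks-sameBlock cross p i e c e₂ c₂ ∙ cong (_+ j * (2 * n)) (onBlock-otherRow cross e e₂ c c₂ row) ∙ arithmetic m₀ j
    where
    arithmetic : ∀ a b → let n = suc a * 2 in 1 + a * 0 + (1 + a * 0) + b * (2 * n) ≡ 2 * b * n + 2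
    arithmetic = solve-∀
  ... | true with ==⇒≡ e e₂ row | c == c₂ in col
  ...   | refl | true rewrite ==⇒≡ c c₂ col = walks-sameBlock cross p i e c₂ e c₂
    ∙ cong (_+ j * (2 * n)) (onBlock-diagonal cross e c₂) ∙ arithmetic m₀ j
    where
    arithmetic : ∀ a b → let n = suc a * 2; n₂ = a * 2 in n₂ + a * 0 + suc a * 0 + b * (2 * n) ≡ 2 * b * n + n₂
    arithmetic = solve-∀
  ...   | refl | false = walks-sameBlock cross p i e c e c₂
    ∙ cancel₂ 0 _ (j * (2 * n)) μ' (onBlock-sameRow-distinct cross e c c₂ col) (arithmetic m₀ j)
    where
    arithmetic : ∀ a b → let n = suc a * 2 in 1 + 1 + suc a * 0 + suc a * 0 + b * (2 * n) ≡ 2 * b * n + 2 + 0 + 0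
    arithmetic = solve-∀

  walks-otherColumn : ∀ p e ℓ p₂ e₂ ℓ₂ →
    ∑Y (λ p' e' ℓ' → walk cross p e ℓ p' e' ℓ' p₂ e₂ ℓ₂) ≡ (if F p e ℓ p₂ e₂ ℓ₂ then λ' else μ')
  walks-otherColumn p e ⋆ p₂ e₂ ⋆ with p == p₂ ∧ e == e₂ in u=v
  ... | true with ==⇒≡ p p₂ (proj₁ (∧-true u=v)) | ==⇒≡ e e₂ (proj₂ (∧-true u=v))
  ...   | refl | refl = ∑Y-split (λ p' e' ℓ' → walk cross p e ⋆ p' e' ℓ' p e ⋆)
    ∙ cong₂ _+_ (walks-⋆→⋆-base cross p e p e ∙ ∑-rows-equal cross (combine p e)) (walks-⋆→⋆-labelled cross p e p e)
    ∙ arithmetic m₀ j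
    where
    arithmetic : ∀ a b → let n = suc a * 2; n₁ = suc (a * 2); n₂ = a * 2 in n₂ + n₁ * 0 + b * (2 * n) ≡ 2 * b * n + n₂
    arithmetic = solve-∀
  walks-otherColumn p e ⋆ p₂ e₂ ⋆ | false = ∑Y-split (λ p' e' ℓ' → walk cross p e ⋆ p' e' ℓ' p₂ e₂ ⋆)
    ∙ cong₂ _+_ (walks-⋆→⋆-base cross p e p₂ e₂) (walks-⋆→⋆-labelled cross p e p₂ e₂)
    ∙ cancel₂ 0 _ (j * (2 * n)) μ' (∑-rows-distinct cross (combine p e) (combine p₂ e₂) (rows-distinct p e p₂ e₂ u=v)) (arithmetic m₀ j)
    where
    arithmetic : ∀ a b → let n = suc a * 2 in 1 + 1 + n * 0 + b * (2 * n) ≡ 2 * b * n + 2 + 0 + 0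
    arithmetic = solve-∀
  walks-otherColumn p e ⋆ p₂ e₂ (lab i₂ c₂) = walks-⋆→lab cross p e p₂ e₂ i₂ c₂
  walks-otherColumn p e (lab i c) p₂ e₂ ⋆ = walks-lab→⋆ cross p e i c p₂ e₂
  walks-otherColumn p e (lab i c) p₂ e₂ (lab i₂ c₂) with p == p₂ ∧ i == i₂ in block
  ... | false = walks-lab→lab cross p e i c p₂ e₂ i₂ c₂ block
  ... | true with ==⇒≡ p p₂ (proj₁ (∧-true block)) | ==⇒≡ i i₂ (proj₂ (∧-true block))
  ...   | refl | refl = walks-otherColumn-block p i e c e₂ c₂

  -- Vertices are encoded in Fin N, N = n · n · (1 + jm): the column x and row 2p + e of
  -- L₂(n), then the label, ⋆ first and lab i c after it.
  N : ℕ
  N = n * n * suc (j * m)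

  label : Fin (suc (j * m)) → Label
  label zero = ⋆
  label (suc t) = lab (proj₁ (remQuot {j} m t)) (proj₂ (remQuot {j} m t))

  labelIndex : Label → Fin (suc (j * m))
  labelIndex ⋆ = zero
  labelIndex (lab i c) = suc (combine i c)

  labelIndex-label : ∀ t → labelIndex (label t) ≡ t
  labelIndex-label zero = refl
  labelIndex-label (suc t) = cong suc (combine-remQuot {j} m t)

  ∑-label : ∀ (g : Label → ℕ) → ∑[ t < suc (j * m) ] g (label t) ≡ ∑L g
  ∑-label g = cong (g ⋆ +_) (∑-remQuot j m (λ i c → g (lab i c)))

  column : Fin N → Fin n
  column w = proj₁ (remQuot {n} n (proj₁ (remQuot {n * n} (suc (j * m)) w)))

  row : Fin N → Fin n
  row w = proj₂ (remQuot {n} n (proj₁ (remQuot {n * n} (suc (j * m)) w)))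

  pairOf : Fin N → Fin m
  pairOf w = proj₁ (remQuot {m} 2 (row w))

  bitOf : Fin N → Fin 2
  bitOf w = proj₂ (remQuot {m} 2 (row w))

  labelOf : Fin N → Label
  labelOf w = label (proj₂ (remQuot {n * n} (suc (j * m)) w))

  encode : Fin n → Fin m → Fin 2 → Label → Fin N
  encode x p e ℓ = combine (combine x (combine p e)) (labelIndex ℓ)

  encode-decode : ∀ w → encode (column w) (pairOf w) (bitOf w) (labelOf w) ≡ w
  encode-decode w = begin
    combine (combine x (combine p e)) (labelIndex (label t)) ≡⟨ cong (combine (combine x (combine p e))) (labelIndex-label t) ⟩
    combine (combine x (combine p e)) t                      ≡⟨ cong (λ y' → combine (combine x y') t) (combine-remQuot {m} 2 y) ⟩
    combine (combine x y) t                                  ≡⟨ cong (λ xy' → combine xy' t) (combine-remQuot {n} n xy) ⟩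
    combine xy t                                             ≡⟨ combine-remQuot {n * n} (suc (j * m)) w ⟩
    w                                                        ∎
    where
    xy = proj₁ (remQuot {n * n} (suc (j * m)) w)
    t = proj₂ (remQuot {n * n} (suc (j * m)) w)
    x = proj₁ (remQuot {n} n xy)
    y = proj₂ (remQuot {n} n xy)
    p = proj₁ (remQuot {m} 2 y)
    e = proj₂ (remQuot {m} 2 y)

  point-injective : ∀ u v → column u ≡ column v → (pairOf u , bitOf u , labelOf u) ≡ (pairOf v , bitOf v , labelOf v) → u ≡ v
  point-injective u v same-column same-point = sym (encode-decode u)
    ∙ cong₂ (λ x (pel : Fin m × Fin 2 × Label) → encode x (proj₁ pel) (proj₁ (proj₂ pel)) (proj₂ (proj₂ pel))) same-column same-point
    ∙ encode-decode v

  A : Fin N → Fin N → Bool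
  A u v = if column u == column v then H (pairOf u) (bitOf u) (labelOf u) (pairOf v) (bitOf v) (labelOf v)
                                  else F (pairOf u) (bitOf u) (labelOf u) (pairOf v) (bitOf v) (labelOf v)

  ∑Y-cong : ∀ {f g : Fin m → Fin 2 → Label → ℕ} → (∀ p e ℓ → f p e ℓ ≡ g p e ℓ) → ∑Y f ≡ ∑Y g
  ∑Y-cong f≡g = sum-cong-≗ {m} λ p → sum-cong-≗ {2} λ e →
    cong₂ _+_ (f≡g p e ⋆) (sum-cong-≗ {j} λ i → sum-cong-≗ {m} λ c → f≡g p e (lab i c))

  ∑-vertices : ∀ (g : Fin n → Fin m → Fin 2 → Label → ℕ) →
    ∑[ w < N ] g (column w) (pairOf w) (bitOf w) (labelOf w) ≡ ∑Y (λ p e ℓ → ∑[ x < n ] g x p e ℓ)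
  ∑-vertices g =
      ∑-remQuot (n * n) (suc (j * m))
        (λ xy t → g (proj₁ (remQuot {n} n xy)) (proj₁ (remQuot {m} 2 (proj₂ (remQuot {n} n xy))))
                    (proj₂ (remQuot {m} 2 (proj₂ (remQuot {n} n xy)))) (label t))
    ∙ ∑-remQuot n n (λ x y → ∑[ t < suc (j * m) ] g x (proj₁ (remQuot {m} 2 y)) (proj₂ (remQuot {m} 2 y)) (label t))
    ∙ sum-cong-≗ {n} (λ x → ∑-remQuot m 2 (λ p e → ∑[ t < suc (j * m) ] g x p e (label t))
                          ∙ sum-cong-≗ {m} λ p → sum-cong-≗ {2} λ e → ∑-label (g x p e))
    ∙ ∑-comm {n} {m} (λ x p → ∑[ e < 2 ] ∑L (g x p e))
    ∙ sum-cong-≗ {m} (λ p → ∑-comm {n} {2} (λ x e → ∑L (g x p e)) ∙ sum-cong-≗ {2} λ e → columns-inside (λ x ℓ → g x p e ℓ))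
    where
    columns-inside : ∀ (f : Fin n → Label → ℕ) → ∑[ x < n ] ∑L (f x) ≡ ∑L (λ ℓ → ∑[ x < n ] f x ℓ)
    columns-inside f = ∑-distrib-+ (λ x → f x ⋆) (λ x → ∑[ i < j ] ∑[ c < m ] f x (lab i c))
      ∙ cong (∑[ x < n ] f x ⋆ +_) (∑-comm {n} {j} (λ x i → ∑[ c < m ] f x (lab i c))
                                    ∙ sum-cong-≗ {j} λ i → ∑-comm {n} {m} (λ x c → f x (lab i c)))

  ⟦if⟧ : ∀ b (h f : Bool) → ⟦ if b then h else f ⟧ ≡ (if b then ⟦ h ⟧ else ⟦ f ⟧)
  ⟦if⟧ true h f = refl
  ⟦if⟧ false h f = refl

  outWeight-count : ∀ h f → ⟦ h ⟧ + n₁ * ⟦ f ⟧ ≡ outWeight h f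
  outWeight-count false false = *-zeroʳ n₁
  outWeight-count true false = cong suc (*-zeroʳ n₁)
  outWeight-count false true = *-identityʳ n₁
  outWeight-count true true = cong suc (*-identityʳ n₁)

  crossWeight-count : ∀ a b c → ⟦ a ⟧ + ⟦ b ⟧ + n₂ * ⟦ c ⟧ ≡ crossWeight a b c
  crossWeight-count a b false = cong (⟦ a ⟧ + ⟦ b ⟧ +_) (*-zeroʳ n₂) ∙ +-identityʳ _
  crossWeight-count a b true = cong (⟦ a ⟧ + ⟦ b ⟧ +_) (*-identityʳ n₂)

  ∑-column-out : ∀ (x : Fin n) h f → ∑[ x' < n ] ⟦ if x == x' then h else f ⟧ ≡ outWeight h f
  ∑-column-out x h f = sum-cong-≗ {n} (λ x' → ⟦if⟧ (x == x') h f) ∙ ∑-pt x ⟦ h ⟧ ⟦ f ⟧ ∙ outWeight-count h f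

  ∑-column-in : ∀ (x : Fin n) h f → ∑[ x' < n ] ⟦ if x' == x then h else f ⟧ ≡ outWeight h f
  ∑-column-in x h f = sum-cong-≗ {n} (λ x' → cong (λ b → ⟦ if b then h else f ⟧) (==-sym x' x)) ∙ ∑-column-out x h f

  ∑-column-walk : ∀ (x x₂ : Fin n) h₁ f₁ h₂ f₂ →
    ∑[ x' < n ] ⟦ (if x == x' then h₁ else f₁) ∧ (if x' == x₂ then h₂ else f₂) ⟧
      ≡ (if x == x₂ then WalkWeight.ω same h₁ f₁ h₂ f₂ else WalkWeight.ω cross h₁ f₁ h₂ f₂)
  ∑-column-walk x x₂ h₁ f₁ h₂ f₂ with x == x₂ in x=x₂
  ... | true rewrite ==⇒≡ x x₂ x=x₂ =
    sum-cong-≗ {n} cell ∙ ∑-pt x₂ ⟦ h₁ ∧ h₂ ⟧ ⟦ f₁ ∧ f₂ ⟧ ∙ outWeight-count (h₁ ∧ h₂) (f₁ ∧ f₂)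
    where
    cell : ∀ x' → ⟦ (if x₂ == x' then h₁ else f₁) ∧ (if x' == x₂ then h₂ else f₂) ⟧ ≡ (if x₂ == x' then ⟦ h₁ ∧ h₂ ⟧ else ⟦ f₁ ∧ f₂ ⟧)
    cell x' rewrite ==-sym x' x₂ with x₂ == x'
    ... | true = refl
    ... | false = refl
  ... | false = sym (+-identityʳ _)
    ∙ cancel₂ ⟦ f₁ ∧ f₂ ⟧ _ 0 _
        (cong (λ s → s + ⟦ f₁ ∧ f₂ ⟧ + ⟦ f₁ ∧ f₂ ⟧) (sum-cong-≗ {n} cell) ∙ ∑-pt₂ x x₂ _ _ _ (==-sym x₂ x ∙ x=x₂))
        (shift ⟦ h₁ ∧ f₂ ⟧ ⟦ f₁ ∧ h₂ ⟧ ⟦ f₁ ∧ f₂ ⟧ m₀ ∙ cong (λ s → s + ⟦ f₁ ∧ f₂ ⟧ + ⟦ f₁ ∧ f₂ ⟧) (crossWeight-count (h₁ ∧ f₂) (f₁ ∧ h₂) (f₁ ∧ f₂)))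
    where
    cell : ∀ x' → ⟦ (if x == x' then h₁ else f₁) ∧ (if x' == x₂ then h₂ else f₂) ⟧
                  ≡ (if x' == x then ⟦ h₁ ∧ f₂ ⟧ else (if x' == x₂ then ⟦ f₁ ∧ h₂ ⟧ else ⟦ f₁ ∧ f₂ ⟧))
    cell x' rewrite ==-sym x x' with x' == x in x'=x
    ... | true rewrite ==⇒≡ x' x x'=x | x=x₂ = refl
    ... | false with x' == x₂
    ...   | true = refl
    ...   | false = refl
    shift : ∀ a b c x → a + b + suc x * 2 * c + 0 ≡ a + b + x * 2 * c + c + c
    shift = solve-∀

  count-out : ∀ u → count (λ w → A u w) ≡ ∑Y (deg (pairOf u) (bitOf u) (labelOf u))
  count-out u = count≡∑ (λ w → A u w)
    ∙ ∑-vertices (λ x p' e' ℓ' → ⟦ if column u == x then H (pairOf u) (bitOf u) (labelOf u) p' e' ℓ' else F (pairOf u) (bitOf u) (labelOf u) p' e' ℓ' ⟧)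
    ∙ ∑Y-cong (λ p' e' ℓ' → ∑-column-out (column u) (H (pairOf u) (bitOf u) (labelOf u) p' e' ℓ') (F (pairOf u) (bitOf u) (labelOf u) p' e' ℓ'))

  count-in : ∀ v → count (λ w → A w v) ≡ ∑Y (λ p' e' ℓ' → deg p' e' ℓ' (pairOf v) (bitOf v) (labelOf v))
  count-in v = count≡∑ (λ w → A w v)
    ∙ ∑-vertices (λ x p' e' ℓ' → ⟦ if x == column v then H p' e' ℓ' (pairOf v) (bitOf v) (labelOf v) else F p' e' ℓ' (pairOf v) (bitOf v) (labelOf v) ⟧)
    ∙ ∑Y-cong (λ p' e' ℓ' → ∑-column-in (column v) (H p' e' ℓ' (pairOf v) (bitOf v) (labelOf v)) (F p' e' ℓ' (pairOf v) (bitOf v) (labelOf v)))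

  module _ (u v : Fin N) where
    private
      p p₂ : Fin m
      p = pairOf u
      p₂ = pairOf v
      e e₂ : Fin 2
      e = bitOf u
      e₂ = bitOf v
      ℓ ℓ₂ : Label
      ℓ = labelOf u
      ℓ₂ = labelOf v

    count-walks : count (λ w → A u w ∧ A w v)
      ≡ ∑Y (λ p' e' ℓ' → if column u == column v then walk same p e ℓ p' e' ℓ' p₂ e₂ ℓ₂ else walk cross p e ℓ p' e' ℓ' p₂ e₂ ℓ₂)
    count-walks = count≡∑ (λ w → A u w ∧ A w v)
      ∙ ∑-vertices (λ x p' e' ℓ' → ⟦ (if column u == x then H p e ℓ p' e' ℓ' else F p e ℓ p' e' ℓ')
                                     ∧ (if x == column v then H p' e' ℓ' p₂ e₂ ℓ₂ else F p' e' ℓ' p₂ e₂ ℓ₂) ⟧)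
      ∙ ∑Y-cong (λ p' e' ℓ' → ∑-column-walk (column u) (column v) (H p e ℓ p' e' ℓ') (F p e ℓ p' e' ℓ') (H p' e' ℓ' p₂ e₂ ℓ₂) (F p' e' ℓ' p₂ e₂ ℓ₂))

    walks-distinct : ¬ u ≡ v → ∀ b → A u v ≡ b →
      ∑Y (λ p' e' ℓ' → if column u == column v then walk same p e ℓ p' e' ℓ' p₂ e₂ ℓ₂ else walk cross p e ℓ p' e' ℓ' p₂ e₂ ℓ₂)
        ≡ (if b then λ' else μ')
    walks-distinct u≢v b Auv≡b with column u == column v in same-column
    ... | true = walks-sameColumn p e ℓ p₂ e₂ ℓ₂ (λ same-point → u≢v (point-injective u v (==⇒≡ _ _ same-column) same-point))
               ∙ cong (λ a → if a then λ' else μ') Auv≡b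
    ... | false = walks-otherColumn p e ℓ p₂ e₂ ℓ₂ ∙ cong (λ a → if a then λ' else μ') Auv≡b

  isDSRG : IsDSRG N k' t' λ' μ' A
  isDSRG = record
    { loopless = λ v → cong (λ b → if b then H (pairOf v) (bitOf v) (labelOf v) (pairOf v) (bitOf v) (labelOf v)
                                           else F (pairOf v) (bitOf v) (labelOf v) (pairOf v) (bitOf v) (labelOf v)) (==-refl (column v))
                     ∙ H-irreflexive (pairOf v) (bitOf v) (labelOf v)
    ; outDeg = λ v → count-out v ∙ out-degree (pairOf v) (bitOf v) (labelOf v)
    ; inDeg = λ v → count-in v ∙ in-degree (pairOf v) (bitOf v) (labelOf v)
    ; sqDiag = λ v → count-walks v v
        ∙ ∑Y-cong (λ p' e' ℓ' → cong (λ b → if b then walk same (pairOf v) (bitOf v) (labelOf v) p' e' ℓ' (pairOf v) (bitOf v) (labelOf v)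
                                                 else walk cross (pairOf v) (bitOf v) (labelOf v) p' e' ℓ' (pairOf v) (bitOf v) (labelOf v))
                                      (==-refl (column v)))
        ∙ walks-diagonal (pairOf v) (bitOf v) (labelOf v)
    ; sqAdj = λ u v u≢v adjacent → count-walks u v ∙ walks-distinct u v u≢v true adjacent
    ; sqNonAdj = λ u v u≢v nonadjacent → count-walks u v ∙ walks-distinct u v u≢v false nonadjacent
    }

dsrg-subst : ∀ {N N' k k' t t' l l' μ μ'} → N ≡ N' → k ≡ k' → t ≡ t' → l ≡ l' → μ ≡ μ' →
  Σ (Digraph N) (IsDSRG N k t l μ) → Σ (Digraph N') (IsDSRG N' k' t' l' μ')
dsrg-subst refl refl refl refl refl dsrg = dsrg

∸2 : ∀ {a b} → a ≡ b + 2 → b ≡ a ∸ 2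
∸2 {a} {b} a≡b+2 = sym (cong (_∸ 2) a≡b+2 ∙ m+n∸n≡m b 2)

-- Write n = 2m with m = m₀ + 1 (n = 0 is excluded by 0 < n); the graph is that of Construction,
-- whose parameters agree with the statement's after evaluating the truncated subtractions.
mainTheorem16 : (n j : ℕ) → 0 < n → 2 ∣ n → 0 < j →
    IsEquitable (n * n) (n / 2) (L2 n) (pairPart n) (quotL2 n)
    × Σ (Digraph (n * n * (1 + j * (n / 2)))) (λ A →
        IsDSRG (n * n * (1 + j * (n / 2)))
               (j * n * n + 2 * n ∸ 2)
               (2 * j * n + 2 * n ∸ 2)
               (2 * j * n + n ∸ 2)
               (2 * j * n + 2) A)
mainTheorem16 .(zero * 2) j () (divides zero refl) _
mainTheorem16 .(suc m₀ * 2) j _ (divides (suc m₀) refl) _ =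
  PairPartition.isEquitable m₀ ,
  dsrg-subst (cong (λ h → n * n * suc (j * h)) (sym (PairPartition.n/2≡m m₀)))
             (∸2 (k-eq m₀ j)) (∸2 (t-eq m₀ j)) (∸2 (λ-eq m₀ j)) refl (A , isDSRG)
  where
  open Construction m₀ j
  k-eq : ∀ a b → let n = suc a * 2; n₂ = a * 2 in b * n * n + 2 * n ≡ b * n * n + 2 + n₂ + n₂ + 2
  k-eq = solve-∀
  t-eq : ∀ a b → let n = suc a * 2; n₂ = a * 2 in 2 * b * n + 2 * n ≡ 2 * b * n + 2 + n₂ + n₂ + 2
  t-eq = solve-∀
  λ-eq : ∀ a b → let n = suc a * 2; n₂ = a * 2 in 2 * b * n + n ≡ 2 * b * n + n₂ + 2
  λ-eq = solve-∀
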